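{- Let $G$ be a finite simple $3$-regular circle graph. Then $G$ is not prime.
   Context: All graphs are finite and simple. A double occurrence word is a finite sequence in which each letter that appears, appears exactly twice. The interlacement graph $\mathcal{I}(W)$ has one vertex per letter, with $a,b$ adjacent iff the letters appear in the order $abab$ or $baba$ in $W$. A circle graph is a simple graph isomorphic to some $\mathcal{I}(W)$. A split $(V_1,X_1;V_2,X_2)$ of a graph $G$ is a partition $V(G)=V_1\cup V_2$ with $|V_1|,|V_2|\ge 2$, together with subsets $X_i\subseteq V_i$, such that every vertex of $X_1$ is adjacent to every vertex of $X_2$ and $G$ has no other edges between $V_1$ and $V_2$. A graph with at least five vertices that has no split is called prime. -}

module Defs where

open import Data.Nat using (ℕ; _≤_; _+_)
open import Data.Bool using (Bool; true; false; if_then_else_; T)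
open import Data.Fin using (Fin)
open import Data.List using (List; _∷_; []; _++_; map; allFin)
open import Data.Nat.ListAction using (sum)
open import Data.Product using (Σ; ∃; _×_; ∃-syntax)
open import Relation.Nullary using (¬_)
open import Relation.Binary.PropositionalEquality using (_≡_; _≢_)
open import Function.Bundles using (_⇔_; _⤖_; Bijection)
open import Data.Fin using (_≟_)

record Graph : Set where
  field
    n     : ℕ
    Adj   : Fin n → Fin n → Bool
    sym   : ∀ u v → Adj u v ≡ Adj v u
    irrefl : ∀ v → Adj v v ≡ false
open Graph public

countB : ∀ {n} → (Fin n → Bool) → ℕ
countB {n} p = sum (map (λ u → if p u then 1 else 0) (allFin n))

degree : (G : Graph) → Fin (n G) → ℕ
degree G v = countB (Adj G v)

Regular : ℕ → Graph → Set
Regular k G = ∀ v → degree G v ≡ k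

occ : ∀ {m} → Fin m → List (Fin m) → ℕ
occ {m} a [] = 0
occ {m} a (b ∷ w) with a ≟ b
... | Relation.Nullary.yes _ = 1 + occ a w
... | Relation.Nullary.no _  = occ a w

DoubleOccurrence : ∀ {m} → List (Fin m) → Set
DoubleOccurrence {m} W = ∀ (a : Fin m) → occ a W ≡ 2

InOrderABAB : ∀ {m} → List (Fin m) → Fin m → Fin m → Set
InOrderABAB W a b =
  ∃[ p ] ∃[ q ] ∃[ r ] ∃[ s ] ∃[ t ]
    (W ≡ p ++ (a ∷ q) ++ (b ∷ r) ++ (a ∷ s) ++ (b ∷ t))

Interlaced : ∀ {m} → List (Fin m) → Fin m → Fin m → Set
Interlaced W a b = a ≢ b × (InOrderABAB W a b Data.Sum.⊎ InOrderABAB W b a)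
  where import Data.Sum

CircleGraph : Graph → Set
CircleGraph G =
  ∃[ m ] Σ (List (Fin m)) λ W → DoubleOccurrence W ×
    Σ (Fin (n G) ⤖ Fin m) λ σ →
      ∀ u v → (T (Adj G u v) ⇔ Interlaced W (Bijection.to σ u) (Bijection.to σ v))

-- A split (V₁,X₁;V₂,X₂): V₁ = {v | side v ≡ true}, V₂ = complement;
-- X₁ ⊆ V₁, X₂ ⊆ V₂; the edges between V₁ and V₂ are exactly X₁ × X₂.
IsSplit : (G : Graph) → (side X₁ X₂ : Fin (n G) → Bool) → Set
IsSplit G side X₁ X₂ =
  2 ≤ countB side ×
  2 ≤ countB (λ v → Data.Bool.not (side v)) ×
  (∀ v → X₁ v ≡ true → side v ≡ true) ×
  (∀ v → X₂ v ≡ true → side v ≡ false) ×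
  (∀ u v → side u ≡ true → side v ≡ false →
     (Adj G u v ≡ true ⇔ (X₁ u ≡ true × X₂ v ≡ true)))
  where import Data.Bool

HasSplit : Graph → Set
HasSplit G = ∃[ side ] ∃[ X₁ ] ∃[ X₂ ] IsSplit G side X₁ X₂

Prime : Graph → Set
Prime G = 5 ≤ n G × ¬ HasSplit G

-- Every 3-regular double occurrence word contains twins: letters u, v whose
-- occurrences are adjacent in both places (u v … u v or u v … v u).  Twins are
-- interlaced with the same letters, so the corresponding vertices have equal
-- neighbourhoods outside {u, v}, and {u, v} is one side of a split.
--
-- To find twins, scan the word from left to right, keeping the stack of letters
-- seen once.  A letter at depth j is interlaced with the j letters above it and
-- with those of its neighbours that have already closed, so it can close only
-- when 3 − j of its neighbours have closed.  A stack cell records that number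
-- and whether its letter was pushed directly after the one below; closing a
-- letter right after closing a letter that was adjacent to it yields twins.
-- Without twins the stack therefore evolves by the moves of a one-player game,
-- and a 30-state automaton reading the stack from the bottom accepts every
-- reachable configuration but not the empty stack after a close.  A move only
-- changes the top four cells, so closure of the accepted set under moves is
-- checked by evaluation on windows of at most four cells.  As the scan of the
-- whole word ends with an empty stack after a close, twins must occur.

module Submission where

open import Defs hiding (sym)

open import Data.Bool using (Bool; true; false; T; not; _∧_; _∨_; if_then_else_)
open import Data.Bool.ListAction using (all; any)
open import Data.Bool.Properties using (T-∧; ∧-zeroʳ)
open import Data.Empty using (⊥; ⊥-elim)
open import Data.Fin using (Fin; zero; suc; _≟_; #_; fromℕ<)
open import Data.Fin.Permutation using (Permutation; _⟨$⟩ʳ_)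
open import Data.List using (List; []; _∷_; _++_; _∷ʳ_; length; map; tabulate; take; drop; _∷ʳ′_; initLast)
open import Data.List.Properties using (≡-dec; ++-assoc; ++-identityʳ; ∷ʳ-++; length-++; length-take; take++drop≡id)
open import Data.List.Membership.Propositional using (_∈_)
open import Data.List.Relation.Unary.All as All using (All; []; _∷_)
open import Data.List.Relation.Unary.All.Properties using (all⁺; all⁻; ++⁻ˡ)
open import Data.List.Relation.Unary.Any using (Any; here; there)
open import Data.List.Relation.Unary.Any.Properties as Any using (any⁺; any⁻)
open import Data.Maybe using (Maybe; just; nothing; maybe; _>>=_)
open import Data.Nat using (ℕ; zero; suc; _+_; _≤_; _<_; _≡ᵇ_; _≤ᵇ_; z≤n; s≤s)
open import Data.Nat.ListAction using () renaming (sum to sumList)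
import Data.Nat.Properties as ℕ
open import Data.Nat.Properties using (+-comm; +-identityʳ; +-suc; suc-injective; m+n≡0⇒m≡0; m+n≡0⇒n≡0; ≡ᵇ⇒≡)
open import Data.Product using (Σ; _×_; _,_; proj₁; proj₂; uncurry)
open import Data.Sum using (_⊎_; inj₁; inj₂)
open import Data.Unit using (tt)
open import Data.Vec using (Vec; lookup; _∷_; [])
open import Function using (_∘_)
open import Function.Bundles using (_⇔_; _⤖_; mk⇔; Equivalence; Bijection)
open import Function.Properties.Bijection using (⤖⇒↔)
open import Relation.Binary using (DecidableEquality)
open import Relation.Binary.PropositionalEquality
open import Relation.Nullary using (¬_; Dec; does; yes; no)
open import Relation.Nullary.Decidable using (toWitness; isYes)

open import Algebra.Properties.CommutativeMonoid.Sum ℕ.+-0-commutativeMonoid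
  using (sum; sum-cong-≗; ∑-distrib-+; sum-permute)

-- Counting

indicator : Bool → ℕ
indicator b = if b then 1 else 0

count : ∀ {k} → (Fin k → Bool) → ℕ
count p = sum (indicator ∘ p)

countB≡count : ∀ {k} (p : Fin k → Bool) → countB p ≡ count p
countB≡count p = go p (λ i → i)
  where
  go : ∀ {j k} (p : Fin k → Bool) (g : Fin j → Fin k) →
       sumList (map (indicator ∘ p) (tabulate g)) ≡ count (p ∘ g)
  go {zero}  p g = refl
  go {suc j} p g = cong (indicator (p (g zero)) +_) (go p (g ∘ suc))

count-cong : ∀ {k} {f g : Fin k → Bool} → (∀ u → f u ≡ g u) → count f ≡ count g
count-cong f≗g = sum-cong-≗ (cong indicator ∘ f≗g)

count-split : ∀ {k} (h f g : Fin k → Bool) →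
              (∀ u → indicator (h u) ≡ indicator (f u) + indicator (g u)) →
              count h ≡ count f + count g
count-split h f g split = trans (sum-cong-≗ split) (∑-distrib-+ (indicator ∘ f) (indicator ∘ g))

count-permute : ∀ {j k} (π : Permutation j k) (f : Fin k → Bool) → count (f ∘ (π ⟨$⟩ʳ_)) ≡ count f
count-permute π f = sym (sum-permute (indicator ∘ f) π)

count-mono : ∀ {k} (f g : Fin k → Bool) → (∀ u → f u ≡ true → g u ≡ true) → count f ≤ count g
count-mono {zero}  f g f⊆g = z≤n
count-mono {suc k} f g f⊆g =
  ℕ.+-mono-≤ (head-mono (f zero) (g zero) (f⊆g zero)) (count-mono (f ∘ suc) (g ∘ suc) (f⊆g ∘ suc))
  where
  head-mono : ∀ a b → (a ≡ true → b ≡ true) → indicator a ≤ indicator b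
  head-mono false b _ = z≤n
  head-mono true  b a⇒b rewrite a⇒b refl = s≤s z≤n

count-false : ∀ {k} {f : Fin k → Bool} → (∀ u → f u ≡ false) → count f ≡ 0
count-false {zero}  _     = refl
count-false {suc k} none rewrite none zero = count-false (none ∘ suc)

count-const-true : ∀ k → count {k} (λ _ → true) ≡ k
count-const-true zero    = refl
count-const-true (suc k) = cong suc (count-const-true k)

count-complement : ∀ {k} (f : Fin k → Bool) → count f + count (not ∘ f) ≡ k
count-complement {k} f = trans (sym (count-split (λ _ → true) f (not ∘ f) (split ∘ f))) (count-const-true k)
  where
  split : ∀ b → 1 ≡ indicator b + indicator (not b)
  split true  = refl
  split false = refl

singleton : ∀ {k} → Fin k → Fin k → Bool
singleton x u = does (u ≟ x)

count-singleton : ∀ {k} (x : Fin k) → count (singleton x) ≡ 1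
count-singleton {suc k} zero    = cong suc (count-false {k} (λ _ → refl))
count-singleton {suc k} (suc x) = trans (count-cong shift) (count-singleton x)
  where
  shift : ∀ u → does (suc u ≟ suc x) ≡ does (u ≟ x)
  shift u with u ≟ x
  ... | yes _ = refl
  ... | no  _ = refl

count-insert : ∀ {k} (f g : Fin k → Bool) (x : Fin k) →
               (∀ u → u ≢ x → f u ≡ g u) → f x ≡ false → g x ≡ true →
               count g ≡ suc (count f)
count-insert f g x same fx gx = begin
  count g                              ≡⟨ count-split g f (singleton x) split ⟩
  count f + count (singleton x)        ≡⟨ cong (count f +_) (count-singleton x) ⟩
  count f + 1                          ≡⟨ +-comm (count f) 1 ⟩
  suc (count f)                        ∎
  where
  open ≡-Reasoning
  split : ∀ u → indicator (g u) ≡ indicator (f u) + indicator (singleton x u)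
  split u with u ≟ x
  ... | yes refl rewrite fx | gx = refl
  ... | no u≢x rewrite same u u≢x = sym (+-identityʳ _)

count-pair : ∀ {k} {p q : Fin k} → p ≢ q → count (λ u → singleton p u ∨ singleton q u) ≡ 2
count-pair {p = p} {q} p≢q =
  trans (count-split _ (singleton p) (singleton q) split) (cong₂ _+_ (count-singleton p) (count-singleton q))
  where
  split : ∀ u → indicator (singleton p u ∨ singleton q u) ≡ indicator (singleton p u) + indicator (singleton q u)
  split u with u ≟ p | u ≟ q
  ... | yes refl | yes refl = ⊥-elim (p≢q refl)
  ... | yes _    | no  _    = refl
  ... | no  _    | yes _    = refl
  ... | no  _    | no  _    = refl

∧-true : ∀ {a b} → a ∧ b ≡ true → a ≡ true × b ≡ true
∧-true {true} {true} _ = refl , refl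

split-by-total : ∀ a t → a ≤ t → t ≤ 2 →
                 indicator (a ≡ᵇ 1) ≡ indicator ((a ≡ᵇ 1) ∧ (t ≡ᵇ 2)) + indicator ((a ≡ᵇ 1) ∧ (t ≡ᵇ 1))
split-by-total 0 _ _ _ = refl
split-by-total 1 1 _ _ = refl
split-by-total 1 2 _ _ = refl
split-by-total 1 (suc (suc (suc _))) _ (s≤s (s≤s ()))
split-by-total (suc (suc _)) _ _ _ = refl

positive : ∀ {k n} → k ≡ suc n → 1 ≤ k
positive refl = s≤s z≤n

-- Double occurrence words

Word : ℕ → Set
Word m = List (Fin m)

module _ {m : ℕ} where

  occ-here : ∀ a (w : Word m) → occ a (a ∷ w) ≡ suc (occ a w)
  occ-here a w with a ≟ a
  ... | yes _   = refl
  ... | no  a≢a = ⊥-elim (a≢a refl)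

  occ-there : ∀ {a x} (w : Word m) → a ≢ x → occ a (x ∷ w) ≡ occ a w
  occ-there {a} {x} w a≢x with a ≟ x
  ... | yes a≡x = ⊥-elim (a≢x a≡x)
  ... | no  _   = refl

  occ-++ : ∀ a (u v : Word m) → occ a (u ++ v) ≡ occ a u + occ a v
  occ-++ a []      v = refl
  occ-++ a (x ∷ u) v with a ≟ x
  ... | yes _ = cong suc (occ-++ a u v)
  ... | no  _ = occ-++ a u v

  occ-++-≡0 : ∀ a (u v : Word m) → occ a (u ++ v) ≡ 0 → occ a u ≡ 0 × occ a v ≡ 0
  occ-++-≡0 a u v h = m+n≡0⇒m≡0 _ h′ , m+n≡0⇒n≡0 _ h′
    where h′ = trans (sym (occ-++ a u v)) h

  occ-mid : ∀ a (u v : Word m) → occ a (u ++ a ∷ v) ≡ suc (occ a u + occ a v)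
  occ-mid a u v = trans (occ-++ a u (a ∷ v)) (trans (cong (occ a u +_) (occ-here a v)) (+-suc _ _))

  occ-≢ : ∀ {a b} (w : Word m) → occ a w ≡ 0 → occ b w ≡ 1 → a ≢ b
  occ-≢ w a∉w b∈w refl with () ← trans (sym a∉w) b∈w

  before : Fin m → Word m → Word m
  before a []      = []
  before a (x ∷ w) with a ≟ x
  ... | yes _ = []
  ... | no  _ = x ∷ before a w

  after : Fin m → Word m → Word m
  after a []      = []
  after a (x ∷ w) with a ≟ x
  ... | yes _ = w
  ... | no  _ = after a w

  occ-before : ∀ a (w : Word m) → occ a (before a w) ≡ 0
  occ-before a []      = refl
  occ-before a (x ∷ w) with a ≟ x
  ... | yes _   = refl
  ... | no  a≢x = trans (occ-there (before a w) a≢x) (occ-before a w)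

  split-first : ∀ a (w : Word m) → 1 ≤ occ a w → w ≡ before a w ++ a ∷ after a w
  split-first a (x ∷ w) h with a ≟ x
  ... | yes refl = refl
  ... | no  _    = cong (x ∷_) (split-first a w h)

  occ-after-first : ∀ a (w : Word m) → 1 ≤ occ a w → occ a w ≡ suc (occ a (after a w))
  occ-after-first a w a∈w = begin
    occ a w                                      ≡⟨ cong (occ a) (split-first a w a∈w) ⟩
    occ a (before a w ++ a ∷ after a w)          ≡⟨ occ-mid a (before a w) (after a w) ⟩
    suc (occ a (before a w) + occ a (after a w)) ≡⟨ cong (λ k → suc (k + occ a (after a w))) (occ-before a w) ⟩
    suc (occ a (after a w))                      ∎
    where open ≡-Reasoning

  before-first : ∀ a (u v : Word m) → occ a u ≡ 0 → before a (u ++ a ∷ v) ≡ u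
  before-first a []      v _ with a ≟ a
  ... | yes _   = refl
  ... | no  a≢a = ⊥-elim (a≢a refl)
  before-first a (x ∷ u) v a∉xu with a ≟ x
  ... | no  _ = cong (x ∷_) (before-first a u v a∉xu)

  after-first : ∀ a (u v : Word m) → occ a u ≡ 0 → after a (u ++ a ∷ v) ≡ v
  after-first a []      v _ with a ≟ a
  ... | yes _   = refl
  ... | no  a≢a = ⊥-elim (a≢a refl)
  after-first a (x ∷ u) v a∉xu with a ≟ x
  ... | no  _ = after-first a u v a∉xu

  after-++ : ∀ a (u v : Word m) → 1 ≤ occ a u → after a (u ++ v) ≡ after a u ++ v
  after-++ a (x ∷ u) v h with a ≟ x
  ... | yes _ = refl
  ... | no  _ = after-++ a u v h

  occ-after-≤ : ∀ a b (w : Word m) → occ b (after a w) ≤ occ b w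
  occ-after-≤ a b []      = z≤n
  occ-after-≤ a b (x ∷ w) with a ≟ x | b ≟ x
  ... | yes _ | yes _ = ℕ.n≤1+n _
  ... | yes _ | no  _ = ℕ.≤-refl
  ... | no  _ | yes _ = ℕ.m≤n⇒m≤1+n (occ-after-≤ a b w)
  ... | no  _ | no  _ = occ-after-≤ a b w

  occ-before-≤ : ∀ a b (w : Word m) → occ b (before a w) ≤ occ b w
  occ-before-≤ a b []      = z≤n
  occ-before-≤ a b (x ∷ w) with a ≟ x
  ... | yes _ = z≤n
  ... | no  _ with b ≟ x
  ...   | yes _ = s≤s (occ-before-≤ a b w)
  ...   | no  _ = occ-before-≤ a b w

  before-++ : ∀ a (u v : Word m) → 1 ≤ occ a u → before a (u ++ v) ≡ before a u
  before-++ a (x ∷ u) v h with a ≟ x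
  ... | yes _ = refl
  ... | no  _ = cong (x ∷_) (before-++ a u v h)

  occ-split : ∀ {a b} (w : Word m) → b ≢ a → 1 ≤ occ a w → occ b w ≡ occ b (before a w) + occ b (after a w)
  occ-split {a} {b} w b≢a a∈w = begin
    occ b w                                        ≡⟨ cong (occ b) (split-first a w a∈w) ⟩
    occ b (before a w ++ a ∷ after a w)            ≡⟨ occ-++ b (before a w) _ ⟩
    occ b (before a w) + occ b (a ∷ after a w)     ≡⟨ cong (occ b (before a w) +_) (occ-there _ b≢a) ⟩
    occ b (before a w) + occ b (after a w)         ∎
    where open ≡-Reasoning

  before-self : ∀ a (w : Word m) → before a (a ∷ w) ≡ []
  before-self a w with a ≟ a
  ... | yes _   = refl
  ... | no  a≢a = ⊥-elim (a≢a refl)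

  before-other : ∀ {a x} (w : Word m) → a ≢ x → before a (x ∷ w) ≡ x ∷ before a w
  before-other {a} {x} w a≢x with a ≟ x
  ... | yes a≡x = ⊥-elim (a≢x a≡x)
  ... | no  _   = refl

  absent-before : ∀ a b (w : Word m) → occ a w ≡ 0 → occ a (before b w) ≡ 0
  absent-before a b w a∉w = ℕ.n≤0⇒n≡0 (ℕ.≤-trans (occ-before-≤ b a w) (ℕ.≤-reflexive a∉w))

  before-antisym : ∀ {a b} (w : Word m) → a ≢ b → occ a w ≡ 1 → occ b w ≡ 1 →
                   occ a (before b w) + occ b (before a w) ≡ 1
  before-antisym {a} {b} (x ∷ w) a≢b a∈ b∈ = cases (a ≟ x) (b ≟ x)
    where
    cases : Dec (a ≡ x) → Dec (b ≡ x) → occ a (before b (x ∷ w)) + occ b (before a (x ∷ w)) ≡ 1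
    cases (yes refl) _ rewrite before-self a w | before-other w (a≢b ∘ sym) | occ-here a (before b w)
                             | absent-before a b w (suc-injective (trans (sym (occ-here a w)) a∈)) = refl
    cases (no a≢x) (yes refl) rewrite before-self b w | before-other w a≢x | occ-here b (before a w)
                                    | absent-before b a w (suc-injective (trans (sym (occ-here b w)) b∈)) = refl
    cases (no a≢x) (no b≢x) rewrite before-other w a≢x | before-other w b≢x
                                  | occ-there (before b w) a≢x | occ-there (before a w) b≢x =
      before-antisym w a≢b (trans (sym (occ-there w a≢x)) a∈) (trans (sym (occ-there w b≢x)) b∈)

  after-absent : ∀ {o x} (P : Word m) → occ x P ≡ 0 → occ x (after o P) ≡ 0
  after-absent {o} {x} P x∉P = ℕ.n≤0⇒n≡0 (ℕ.≤-trans (occ-after-≤ o x P) (ℕ.≤-reflexive x∉P))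

  after-self-absent : ∀ {o} (P : Word m) → occ o P ≡ 1 → occ o (after o P) ≡ 0
  after-self-absent {o} P o-once = suc-injective (trans (sym (occ-after-first o P (positive o-once))) o-once)

  between : Fin m → Word m → Word m
  between a w = before a (after a w)

  twice⇒absent-elsewhere : ∀ a (u v t : Word m) → occ a (u ++ a ∷ v ++ a ∷ t) ≡ 2 →
                           occ a u ≡ 0 × occ a v ≡ 0 × occ a t ≡ 0
  twice⇒absent-elsewhere a u v t two =
    m+n≡0⇒m≡0 (occ a u) rest , m+n≡0⇒m≡0 (occ a v) rest′ , m+n≡0⇒n≡0 (occ a v) rest′
    where
    rest : occ a u + (occ a v + occ a t) ≡ 0
    rest = suc-injective (suc-injective (begin
      suc (suc (occ a u + (occ a v + occ a t)))   ≡⟨ cong suc (+-suc (occ a u) _) ⟨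
      suc (occ a u + suc (occ a v + occ a t))     ≡⟨ cong (λ z → suc (occ a u + z)) (occ-mid a v t) ⟨
      suc (occ a u + occ a (v ++ a ∷ t))          ≡⟨ occ-mid a u (v ++ a ∷ t) ⟨
      occ a (u ++ a ∷ v ++ a ∷ t)                 ≡⟨ two ⟩
      2                                           ∎))
      where open ≡-Reasoning
    rest′ = m+n≡0⇒n≡0 (occ a u) rest

  split-at-both : ∀ a (w : Word m) → occ a w ≡ 2 →
                  Σ (Word m) λ u → Σ (Word m) λ t → w ≡ u ++ a ∷ between a w ++ a ∷ t
  split-at-both a w two = before a w , after a (after a w) , trans first (cong (λ z → before a w ++ a ∷ z) second)
    where
    first = split-first a w (positive two)
    once : occ a (after a w) ≡ 1
    once = suc-injective (trans (sym (occ-after-first a w (positive two))) two)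
    second = split-first a (after a w) (positive once)

  between-first : ∀ {a} {w : Word m} (u v t : Word m) → occ a w ≡ 2 → w ≡ u ++ a ∷ v ++ a ∷ t → between a w ≡ v
  between-first {a} u v t two refl =
    trans (cong (before a) (after-first a u (v ++ a ∷ t) (proj₁ gaps))) (before-first a v t (proj₁ (proj₂ gaps)))
    where gaps = twice⇒absent-elsewhere a u v t two

  -- Decides Interlaced on double occurrence words (interlaced⇒, interlaced⇐); a letter
  -- never lies between its own occurrences, so the case a = b needs no separate test.
  interlacedᵇ : Word m → Fin m → Fin m → Bool
  interlacedᵇ w a b = occ b (between a w) ≡ᵇ 1

  occ-∷-≡0 : ∀ {a x} (w : Word m) → occ a (x ∷ w) ≡ 0 → occ a w ≡ 0
  occ-∷-≡0 {a} {x} w h with a ≟ x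
  ... | no _ = h

  occ-around : ∀ {a b} (u v t : Word m) → b ≢ a → occ b (u ++ a ∷ v ++ a ∷ t) ≡ occ b u + (occ b v + occ b t)
  occ-around {a} {b} u v t b≢a = begin
    occ b (u ++ a ∷ v ++ a ∷ t)         ≡⟨ occ-++ b u _ ⟩
    occ b u + occ b (a ∷ v ++ a ∷ t)    ≡⟨ cong (occ b u +_) (occ-there _ b≢a) ⟩
    occ b u + occ b (v ++ a ∷ t)        ≡⟨ cong (occ b u +_) (occ-++ b v _) ⟩
    occ b u + (occ b v + occ b (a ∷ t)) ≡⟨ cong (λ z → occ b u + (occ b v + z)) (occ-there t b≢a) ⟩
    occ b u + (occ b v + occ b t)       ∎
    where open ≡-Reasoning

  regroup : ∀ (p : Word m) x (q : Word m) y (rest : Word m) → p ++ x ∷ q ++ y ∷ rest ≡ (p ++ x ∷ q) ++ y ∷ rest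
  regroup p x q y rest = sym (++-assoc p (x ∷ q) (y ∷ rest))

  between-alternating : ∀ {x y} (w p q r s t : Word m) → occ x w ≡ 2 → occ y w ≡ 2 →
                        w ≡ p ++ x ∷ q ++ y ∷ r ++ x ∷ s ++ y ∷ t →
                        occ y (between x w) ≡ 1 × occ x (between y w) ≡ 1
  between-alternating {x} {y} w p q r s t x-twice y-twice w≡ = y-once , x-once
    where
    x-form : w ≡ p ++ x ∷ (q ++ y ∷ r) ++ x ∷ s ++ y ∷ t
    x-form = trans w≡ (cong (λ z → p ++ x ∷ z) (regroup q y r x (s ++ y ∷ t)))
    y-form : w ≡ (p ++ x ∷ q) ++ y ∷ (r ++ x ∷ s) ++ y ∷ t
    y-form = trans w≡ (trans (regroup p x q y _) (cong (λ z → (p ++ x ∷ q) ++ y ∷ z) (regroup r x s y t)))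
    x-split = twice⇒absent-elsewhere x p (q ++ y ∷ r) (s ++ y ∷ t) (trans (sym (cong (occ x) x-form)) x-twice)
    y-split = twice⇒absent-elsewhere y (p ++ x ∷ q) (r ++ x ∷ s) t (trans (sym (cong (occ y) y-form)) y-twice)
    y∉q = occ-∷-≡0 q (proj₂ (occ-++-≡0 y p (x ∷ q) (proj₁ y-split)))
    y∉r = proj₁ (occ-++-≡0 y r (x ∷ s) (proj₁ (proj₂ y-split)))
    x∉r = occ-∷-≡0 r (proj₂ (occ-++-≡0 x q (y ∷ r) (proj₁ (proj₂ x-split))))
    x∉s = proj₁ (occ-++-≡0 x s (y ∷ t) (proj₂ (proj₂ x-split)))
    y-once : occ y (between x w) ≡ 1
    y-once = begin
      occ y (between x w)       ≡⟨ cong (occ y) (between-first p (q ++ y ∷ r) (s ++ y ∷ t) x-twice x-form) ⟩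
      occ y (q ++ y ∷ r)        ≡⟨ occ-mid y q r ⟩
      suc (occ y q + occ y r)   ≡⟨ cong₂ (λ i j → suc (i + j)) y∉q y∉r ⟩
      1                         ∎
      where open ≡-Reasoning
    x-once : occ x (between y w) ≡ 1
    x-once = begin
      occ x (between y w)       ≡⟨ cong (occ x) (between-first (p ++ x ∷ q) (r ++ x ∷ s) t y-twice y-form) ⟩
      occ x (r ++ x ∷ s)        ≡⟨ occ-mid x r s ⟩
      suc (occ x r + occ x s)   ≡⟨ cong₂ (λ i j → suc (i + j)) x∉r x∉s ⟩
      1                         ∎
      where open ≡-Reasoning

  module _ {w : Word m} (dow : DoubleOccurrence w) where

    interlaced⇒ : ∀ {a b} → Interlaced w a b → interlacedᵇ w a b ≡ true
    interlaced⇒ {a} {b} (_ , inj₁ (p , q , r , s , t , w≡)) =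
      cong (_≡ᵇ 1) (proj₁ (between-alternating w p q r s t (dow a) (dow b) w≡))
    interlaced⇒ {a} {b} (_ , inj₂ (p , q , r , s , t , w≡)) =
      cong (_≡ᵇ 1) (proj₂ (between-alternating w p q r s t (dow b) (dow a) w≡))

    interlaced⇐ : ∀ {a b} → interlacedᵇ w a b ≡ true → Interlaced w a b
    interlaced⇐ {a} {b} h with split-at-both a w (dow a)
    ... | u , t , w≡ = a≢b , orders
      where
      v = between a w
      b-once : occ b v ≡ 1
      b-once = ≡ᵇ⇒≡ _ _ (subst T (sym h) _)
      a∉v : occ a v ≡ 0
      a∉v = proj₁ (proj₂ (twice⇒absent-elsewhere a u v t (trans (cong (occ a) (sym w≡)) (dow a))))
      a≢b = occ-≢ v a∉v b-once
      v≡ = split-first b v (positive b-once)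
      v₁ = before b v
      v₂ = after b v
      outside : occ b u + (1 + occ b t) ≡ 2
      outside = trans (cong (λ z → occ b u + (z + occ b t)) (sym b-once))
                      (trans (sym (occ-around u v t (a≢b ∘ sym))) (trans (cong (occ b) (sym w≡)) (dow b)))
      orders : InOrderABAB w a b ⊎ InOrderABAB w b a
      orders with occ b t in b∈t
      ... | suc _ = inj₁ (u , v₁ , v₂ , before b t , after b t , w≡abab)
        where
        t≡ = split-first b t (positive b∈t)
        w≡abab = trans w≡ (trans (cong₂ (λ x y → u ++ a ∷ x ++ a ∷ y) v≡ t≡)
                                 (cong (λ z → u ++ a ∷ z) (++-assoc v₁ (b ∷ v₂) _)))
      ... | zero = inj₂ (before b u , after b u , v₁ , v₂ , t , w≡baba)
        where
        b-once-in-u : occ b u ≡ 1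
        b-once-in-u = suc-injective (trans (+-comm 1 (occ b u))
                                           (trans (cong (λ z → occ b u + suc z) (sym b∈t)) outside))
        u≡ = split-first b u (positive b-once-in-u)
        w≡baba = trans w≡ (trans (cong₂ (λ x y → x ++ a ∷ y ++ a ∷ t) u≡ v≡)
                                 (trans (++-assoc (before b u) (b ∷ after b u) _)
                                        (cong (λ z → before b u ++ b ∷ after b u ++ a ∷ z) (++-assoc v₁ (b ∷ v₂) _))))

  occ-snoc-other : ∀ {b x} (q : Word m) → b ≢ x → occ b (q ∷ʳ x) ≡ occ b q
  occ-snoc-other {b} q b≢x = trans (occ-++ b q _) (trans (cong (occ b q +_) (occ-there [] b≢x)) (+-identityʳ _))

  occ-snoc-self : ∀ x (P : Word m) → occ x (P ∷ʳ x) ≡ suc (occ x P)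
  occ-snoc-self x P = trans (occ-++ x P _) (trans (cong (occ x P +_) (occ-here x [])) (+-comm (occ x P) 1))

  first-occurrence : ∀ {x} (P : Word m) → occ x P ≡ 0 → occ x (P ∷ʳ x) ≡ 1
  first-occurrence {x} P x∉P = trans (occ-snoc-self x P) (cong suc x∉P)

  second-occurrence : ∀ {x} (P : Word m) → occ x P ≡ 1 → occ x (P ∷ʳ x) ≡ 2
  second-occurrence {x} P x-once = trans (occ-snoc-self x P) (cong suc x-once)

  after-snoc : ∀ (P : Word m) {o} x → occ o P ≡ 1 → after o (P ∷ʳ x) ≡ after o P ∷ʳ x
  after-snoc P {o} x o-once = after-++ o P (x ∷ []) (positive o-once)

  occ-after-snoc-self : ∀ (P : Word m) {o} x → occ o P ≡ 1 → occ x (after o (P ∷ʳ x)) ≡ suc (occ x (after o P))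
  occ-after-snoc-self P {o} x o-once = trans (cong (occ x) (after-snoc P x o-once)) (occ-snoc-self x (after o P))

  occ-after-snoc-other : ∀ (P : Word m) {o x b} → occ o P ≡ 1 → b ≢ x → occ b (after o (P ∷ʳ x)) ≡ occ b (after o P)
  occ-after-snoc-other P {o} {x} o-once b≢x =
    trans (cong (occ _) (after-snoc P x o-once)) (occ-snoc-other (after o P) b≢x)

  before-snoc : ∀ (P : Word m) {o} x → occ o P ≡ 1 → before o (P ∷ʳ x) ≡ before o P
  before-snoc P {o} x o-once = before-++ o P (x ∷ []) (positive o-once)

  before-++-absent : ∀ a (u v : Word m) → occ a u ≡ 0 → before a (u ++ v) ≡ u ++ before a v
  before-++-absent a []      v _ = refl
  before-++-absent a (x ∷ u) v a∉xu with a ≟ x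
  ... | no _ = cong (x ∷_) (before-++-absent a u v a∉xu)

  Adjacent : Word m → Fin m → Fin m → Set
  Adjacent P a b = Σ (Word m) λ A → Σ (Word m) λ B → P ≡ A ++ a ∷ b ∷ B

  AdjacentEither : Word m → Fin m → Fin m → Set
  AdjacentEither P a b = Adjacent P a b ⊎ Adjacent P b a

  Adjacent-++ : ∀ {P a b} Q → Adjacent P a b → Adjacent (P ++ Q) a b
  Adjacent-++ {a = a} {b} Q (A , B , refl) = A , B ++ Q , ++-assoc A (a ∷ b ∷ B) Q

  record Twins (w : Word m) : Set where
    field
      u v      : Fin m
      distinct : u ≢ v
      p q r    : Word m
      shape    : w ≡ p ++ u ∷ v ∷ q ++ u ∷ v ∷ r ⊎ w ≡ p ++ u ∷ v ∷ q ++ v ∷ u ∷ r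

  twins-alike : ∀ {w b} → DoubleOccurrence w → (tw : Twins w) →
                b ≢ Twins.u tw → b ≢ Twins.v tw → interlacedᵇ w (Twins.u tw) b ≡ interlacedᵇ w (Twins.v tw) b
  twins-alike {w} {b} dow tw b≢u b≢v = cong (_≡ᵇ 1) (alike shape)
    where
    open Twins tw
    alike : w ≡ p ++ u ∷ v ∷ q ++ u ∷ v ∷ r ⊎ w ≡ p ++ u ∷ v ∷ q ++ v ∷ u ∷ r →
            occ b (between u w) ≡ occ b (between v w)
    alike (inj₁ w≡) = begin
      occ b (between u w)    ≡⟨ cong (occ b) (between-first p (v ∷ q) (v ∷ r) (dow u) w≡) ⟩
      occ b (v ∷ q)          ≡⟨ occ-there q b≢v ⟩
      occ b q                ≡⟨ occ-snoc-other q b≢u ⟨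
      occ b (q ∷ʳ u)         ≡⟨ cong (occ b) (between-first (p ∷ʳ u) (q ∷ʳ u) r (dow v) v-form) ⟨
      occ b (between v w)    ∎
      where
      open ≡-Reasoning
      v-form = trans w≡ (trans (regroup p u [] v _) (cong (λ z → (p ∷ʳ u) ++ v ∷ z) (regroup q u [] v r)))
    alike (inj₂ w≡) = begin
      occ b (between u w)       ≡⟨ cong (occ b) (between-first p (v ∷ q ∷ʳ v) r (dow u) u-form) ⟩
      occ b (v ∷ q ∷ʳ v)        ≡⟨ occ-there (q ∷ʳ v) b≢v ⟩
      occ b (q ∷ʳ v)            ≡⟨ occ-snoc-other q b≢v ⟩
      occ b q                   ≡⟨ cong (occ b) (between-first (p ∷ʳ u) q (u ∷ r) (dow v) v-form) ⟨
      occ b (between v w)       ∎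
      where
      open ≡-Reasoning
      u-form = trans w≡ (cong (λ z → p ++ u ∷ v ∷ z) (regroup q v [] u r))
      v-form = trans w≡ (regroup p u [] v _)

-- The stack game and its automaton

-- The number of neighbours of an open letter that have already closed, and whether
-- the letter was pushed directly after the letter below it.
record Cell : Set where
  constructor cell
  field
    closedNbrs : ℕ
    linked     : Bool
open Cell public

Stack : Set
Stack = List Cell

-- After a close, the depths of the letters that were adjacent in the word to the letter
-- just closed; closing one of them next would produce twins.
data LastMove : Set where
  start pushed : LastMove
  closed       : List ℕ → LastMove

isPushed : LastMove → Bool
isPushed pushed = true
isPushed _      = false

newCell : LastMove → Cell
newCell l = cell 0 (isPushed l)

bump : Cell → Cell
bump (cell k b) = cell (suc k) b

unlink : Cell → Cell
unlink (cell k _) = cell k false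

at : {A : Set} → ℕ → List A → Maybe A
at _       []       = nothing
at zero    (x ∷ _)  = just x
at (suc j) (_ ∷ xs) = at j xs

linkedAt : ℕ → Stack → Bool
linkedAt j cs = maybe linked false (at j cs)

-- The letters above the closing one are its neighbours; the one directly above it
-- gets a new lower neighbour and so loses its link.
closeAt : ℕ → Stack → Stack
closeAt _             []       = []
closeAt zero          (_ ∷ cs) = cs
closeAt (suc zero)    (c ∷ cs) = unlink (bump c) ∷ closeAt zero cs
closeAt (suc (suc j)) (c ∷ cs) = bump c ∷ closeAt (suc j) cs

when : Bool → ℕ → List ℕ
when b j = if b then j ∷ [] else []

-- After closing depth j, the letter directly above (still at depth j − 1) is adjacent
-- in the word to the closed letter if its cell is linked, and the letter directly below
-- (now at depth j) is if the closed cell is linked.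
adjacentDepths : ℕ → Stack → List ℕ
adjacentDepths zero          cs       = when (linkedAt 0 cs) 0
adjacentDepths (suc zero)    cs       = when (linkedAt 0 cs) 0 ++ when (linkedAt 1 cs) 1
adjacentDepths (suc (suc j)) []       = []
adjacentDepths (suc (suc j)) (_ ∷ cs) = map suc (adjacentDepths (suc j) cs)

forbidden : ℕ → LastMove → Bool
forbidden j (closed ds) = any (j ≡ᵇ_) ds
forbidden j _           = false

atMost3 : Cell → Bool
atMost3 c = closedNbrs c ≤ᵇ 3

complete : ℕ → Stack → Bool
complete j cs = maybe (λ c → closedNbrs c + j ≡ᵇ 3) false (at j cs)

closable : ℕ → Stack → LastMove → Bool
closable j cs l = complete j cs ∧ (not (forbidden j l) ∧ all atMost3 (closeAt j cs))

data Reachable : Stack → LastMove → Set where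
  start : Reachable [] start
  push  : ∀ {cs l} → Reachable cs l → Reachable (newCell l ∷ cs) pushed
  close : ∀ {cs l} j → T (closable j cs l) → Reachable cs l → Reachable (closeAt j cs) (closed (adjacentDepths j cs))

data State : Set where
  s0 s1 s2 s3 s4 s5 s6 s7 s8 s9 s10 s11 s12 s13 s14 s15 s16 s17 s18 s19 : State
  s20 s21 s22 s23 s24 s25 s26 s27 s28 s29                                 : State

∅ : Maybe State
∅ = nothing

⟨_⟩ : State → Maybe State
⟨_⟩ = just

-- The successors of a state on the cells (0,F) (0,T) (1,F) … (3,T); a cell with more
-- than three closed neighbours leads nowhere.
row : State → Vec (Maybe State) 8
row s0  = ⟨ s1 ⟩  ∷ ∅       ∷ ⟨ s2 ⟩  ∷ ∅       ∷ ⟨ s3 ⟩  ∷ ∅       ∷ ∅       ∷ ∅       ∷ []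
row s1  = ∅       ∷ ⟨ s1 ⟩  ∷ ⟨ s4 ⟩  ∷ ∅       ∷ ⟨ s5 ⟩  ∷ ∅       ∷ ∅       ∷ ∅       ∷ []
row s2  = ∅       ∷ ∅       ∷ ∅       ∷ ⟨ s6 ⟩  ∷ ⟨ s7 ⟩  ∷ ∅       ∷ ⟨ s8 ⟩  ∷ ∅       ∷ []
row s3  = ∅       ∷ ∅       ∷ ∅       ∷ ∅       ∷ ∅       ∷ ∅       ∷ ⟨ s9 ⟩  ∷ ∅       ∷ []
row s4  = ∅       ∷ ∅       ∷ ∅       ∷ ⟨ s10 ⟩ ∷ ⟨ s7 ⟩  ∷ ∅       ∷ ⟨ s8 ⟩  ∷ ∅       ∷ []
row s5  = ∅       ∷ ∅       ∷ ∅       ∷ ∅       ∷ ∅       ∷ ∅       ∷ ⟨ s11 ⟩ ∷ ∅       ∷ []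
row s6  = ∅       ∷ ∅       ∷ ⟨ s6 ⟩  ∷ ⟨ s12 ⟩ ∷ ⟨ s13 ⟩ ∷ ∅       ∷ ⟨ s9 ⟩  ∷ ∅       ∷ []
row s7  = ∅       ∷ ∅       ∷ ⟨ s14 ⟩ ∷ ∅       ∷ ⟨ s13 ⟩ ∷ ∅       ∷ ⟨ s9 ⟩  ∷ ∅       ∷ []
row s8  = ∅       ∷ ∅       ∷ ⟨ s15 ⟩ ∷ ∅       ∷ ⟨ s16 ⟩ ∷ ∅       ∷ ⟨ s9 ⟩  ∷ ∅       ∷ []
row s9  = ∅       ∷ ∅       ∷ ⟨ s15 ⟩ ∷ ∅       ∷ ⟨ s17 ⟩ ∷ ∅       ∷ ⟨ s9 ⟩  ∷ ∅       ∷ []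
row s10 = ∅       ∷ ∅       ∷ ⟨ s6 ⟩  ∷ ⟨ s18 ⟩ ∷ ⟨ s13 ⟩ ∷ ∅       ∷ ⟨ s9 ⟩  ∷ ∅       ∷ []
row s11 = ∅       ∷ ∅       ∷ ⟨ s15 ⟩ ∷ ∅       ∷ ⟨ s19 ⟩ ∷ ∅       ∷ ⟨ s9 ⟩  ∷ ∅       ∷ []
row s12 = ⟨ s1 ⟩  ∷ ∅       ∷ ⟨ s2 ⟩  ∷ ∅       ∷ ⟨ s3 ⟩  ∷ ∅       ∷ ∅       ∷ ∅       ∷ []
row s13 = ∅       ∷ ∅       ∷ ⟨ s20 ⟩ ∷ ∅       ∷ ⟨ s13 ⟩ ∷ ∅       ∷ ⟨ s9 ⟩  ∷ ∅       ∷ []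
row s14 = ⟨ s1 ⟩  ∷ ∅       ∷ ⟨ s21 ⟩ ∷ ⟨ s22 ⟩ ∷ ⟨ s13 ⟩ ∷ ∅       ∷ ⟨ s9 ⟩  ∷ ∅       ∷ []
row s15 = ⟨ s1 ⟩  ∷ ∅       ∷ ⟨ s21 ⟩ ∷ ⟨ s22 ⟩ ∷ ⟨ s13 ⟩ ∷ ∅       ∷ ⟨ s9 ⟩  ∷ ∅       ∷ []
row s16 = ⟨ s1 ⟩  ∷ ∅       ∷ ⟨ s23 ⟩ ∷ ∅       ∷ ⟨ s13 ⟩ ∷ ∅       ∷ ⟨ s9 ⟩  ∷ ∅       ∷ []
row s17 = ⟨ s1 ⟩  ∷ ∅       ∷ ⟨ s23 ⟩ ∷ ∅       ∷ ⟨ s13 ⟩ ∷ ∅       ∷ ⟨ s9 ⟩  ∷ ∅       ∷ []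
row s18 = ⟨ s1 ⟩  ∷ ∅       ∷ ⟨ s2 ⟩  ∷ ∅       ∷ ⟨ s3 ⟩  ∷ ∅       ∷ ∅       ∷ ∅       ∷ []
row s19 = ⟨ s1 ⟩  ∷ ∅       ∷ ⟨ s23 ⟩ ∷ ∅       ∷ ⟨ s13 ⟩ ∷ ∅       ∷ ⟨ s9 ⟩  ∷ ∅       ∷ []
row s20 = ⟨ s1 ⟩  ∷ ∅       ∷ ⟨ s21 ⟩ ∷ ⟨ s22 ⟩ ∷ ⟨ s13 ⟩ ∷ ∅       ∷ ⟨ s9 ⟩  ∷ ∅       ∷ []
row s21 = ∅       ∷ ∅       ∷ ⟨ s6 ⟩  ∷ ⟨ s24 ⟩ ∷ ⟨ s25 ⟩ ∷ ∅       ∷ ⟨ s26 ⟩ ∷ ∅       ∷ []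
row s22 = ⟨ s1 ⟩  ∷ ∅       ∷ ⟨ s2 ⟩  ∷ ∅       ∷ ⟨ s3 ⟩  ∷ ∅       ∷ ∅       ∷ ∅       ∷ []
row s23 = ⟨ s1 ⟩  ∷ ∅       ∷ ⟨ s21 ⟩ ∷ ⟨ s27 ⟩ ∷ ⟨ s25 ⟩ ∷ ∅       ∷ ⟨ s26 ⟩ ∷ ∅       ∷ []
row s24 = ⟨ s1 ⟩  ∷ ∅       ∷ ⟨ s21 ⟩ ∷ ⟨ s12 ⟩ ∷ ⟨ s13 ⟩ ∷ ∅       ∷ ⟨ s9 ⟩  ∷ ∅       ∷ []
row s25 = ∅       ∷ ∅       ∷ ⟨ s28 ⟩ ∷ ∅       ∷ ⟨ s13 ⟩ ∷ ∅       ∷ ⟨ s9 ⟩  ∷ ∅       ∷ []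
row s26 = ∅       ∷ ∅       ∷ ⟨ s15 ⟩ ∷ ∅       ∷ ⟨ s29 ⟩ ∷ ∅       ∷ ⟨ s9 ⟩  ∷ ∅       ∷ []
row s27 = ⟨ s1 ⟩  ∷ ∅       ∷ ⟨ s21 ⟩ ∷ ⟨ s12 ⟩ ∷ ⟨ s13 ⟩ ∷ ∅       ∷ ⟨ s9 ⟩  ∷ ∅       ∷ []
row s28 = ⟨ s1 ⟩  ∷ ∅       ∷ ⟨ s21 ⟩ ∷ ⟨ s22 ⟩ ∷ ⟨ s13 ⟩ ∷ ∅       ∷ ⟨ s9 ⟩  ∷ ∅       ∷ []
row s29 = ⟨ s1 ⟩  ∷ ∅       ∷ ⟨ s23 ⟩ ∷ ∅       ∷ ⟨ s13 ⟩ ∷ ∅       ∷ ⟨ s9 ⟩  ∷ ∅       ∷ []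

entry : Cell → Vec (Maybe State) 8 → Maybe State
entry (cell 0 false) r = lookup r (# 0)
entry (cell 0 true)  r = lookup r (# 1)
entry (cell 1 false) r = lookup r (# 2)
entry (cell 1 true)  r = lookup r (# 3)
entry (cell 2 false) r = lookup r (# 4)
entry (cell 2 true)  r = lookup r (# 5)
entry (cell 3 false) r = lookup r (# 6)
entry (cell 3 true)  r = lookup r (# 7)
entry (cell (suc (suc (suc (suc _)))) _) _ = nothing

step : State → Cell → Maybe State
step q c = entry c (row q)

run : Stack → State → Maybe State
run []       q = just q
run (c ∷ cs) q = run cs q >>= λ q′ → step q′ c

acceptedAfter : State → List LastMove
acceptedAfter s0  = start ∷ []
acceptedAfter s1  = pushed ∷ []
acceptedAfter s2  = []
acceptedAfter s3  = []
acceptedAfter s4  = []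
acceptedAfter s5  = []
acceptedAfter s6  = []
acceptedAfter s7  = []
acceptedAfter s8  = []
acceptedAfter s9  = []
acceptedAfter s10 = []
acceptedAfter s11 = []
acceptedAfter s12 = (closed (2 ∷ [])) ∷ []
acceptedAfter s13 = []
acceptedAfter s14 = (closed (1 ∷ 2 ∷ [])) ∷ []
acceptedAfter s15 = (closed []) ∷ []
acceptedAfter s16 = (closed (2 ∷ [])) ∷ []
acceptedAfter s17 = (closed []) ∷ []
acceptedAfter s18 = (closed (2 ∷ 3 ∷ [])) ∷ []
acceptedAfter s19 = (closed (3 ∷ [])) ∷ []
acceptedAfter s20 = (closed (1 ∷ [])) ∷ []
acceptedAfter s21 = []
acceptedAfter s22 = (closed []) ∷ []
acceptedAfter s23 = (closed (1 ∷ [])) ∷ []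
acceptedAfter s24 = (closed (2 ∷ [])) ∷ []
acceptedAfter s25 = []
acceptedAfter s26 = []
acceptedAfter s27 = (closed []) ∷ []
acceptedAfter s28 = (closed (1 ∷ [])) ∷ (closed (1 ∷ 2 ∷ [])) ∷ []
acceptedAfter s29 = (closed []) ∷ (closed (2 ∷ [])) ∷ []

_≟ₗ_ : DecidableEquality LastMove
start     ≟ₗ start     = yes refl
pushed    ≟ₗ pushed    = yes refl
closed ds ≟ₗ closed es with ≡-dec ℕ._≟_ ds es
... | yes refl = yes refl
... | no  ds≢es = no λ { refl → ds≢es refl }
start     ≟ₗ pushed    = no λ ()
start     ≟ₗ closed _  = no λ ()
pushed    ≟ₗ start     = no λ ()
pushed    ≟ₗ closed _  = no λ ()
closed _  ≟ₗ start     = no λ ()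
closed _  ≟ₗ pushed    = no λ ()

open import Data.List.Membership.DecPropositional _≟ₗ_ using (_∈?_)

acceptsFrom : State → Stack → LastMove → Bool
acceptsFrom q cs l = maybe (λ q′ → isYes (l ∈? acceptedAfter q′)) false (run cs q)

accepts : Stack → LastMove → Bool
accepts = acceptsFrom s0

_⇒ᵇ_ : Bool → Bool → Bool
a ⇒ᵇ b = not a ∨ b

closeAccepted : State → Stack → LastMove → ℕ → Bool
closeAccepted q w l j = closable j w l ⇒ᵇ acceptsFrom q (closeAt j w) (closed (adjacentDepths j w))

successorsAccepted : State → Stack → LastMove → Bool
successorsAccepted q w l = acceptsFrom q (newCell l ∷ w) pushed ∧ all (closeAccepted q w l) (0 ∷ 1 ∷ 2 ∷ 3 ∷ [])

windowClosed : State → Stack → Bool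
windowClosed q w = maybe (λ q′ → all (successorsAccepted q w) (acceptedAfter q′)) true (run w q)

allCells : List Cell
allCells = cell 0 false ∷ cell 0 true ∷ cell 1 false ∷ cell 1 true
         ∷ cell 2 false ∷ cell 2 true ∷ cell 3 false ∷ cell 3 true ∷ []

windowsUpTo : ℕ → State → Stack → (Stack → Bool) → Bool
windowsUpTo zero    _ acc p = p acc
windowsUpTo (suc k) q acc p = p acc ∧ all (λ c → maybe (λ q′ → windowsUpTo k q′ (c ∷ acc) p) true (step q c)) allCells

certificate : ∀ q → T (windowsUpTo 4 q [] (windowClosed q))
certificate s0 = tt
certificate s1 = tt
certificate s2 = tt
certificate s3 = tt
certificate s4 = tt
certificate s5 = tt
certificate s6 = tt
certificate s7 = tt
certificate s8 = tt
certificate s9 = tt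
certificate s10 = tt
certificate s11 = tt
certificate s12 = tt
certificate s13 = tt
certificate s14 = tt
certificate s15 = tt
certificate s16 = tt
certificate s17 = tt
certificate s18 = tt
certificate s19 = tt
certificate s20 = tt
certificate s21 = tt
certificate s22 = tt
certificate s23 = tt
certificate s24 = tt
certificate s25 = tt
certificate s26 = tt
certificate s27 = tt
certificate s28 = tt
certificate s29 = tt

run-++ : ∀ (w r : Stack) q → run (w ++ r) q ≡ (run r q >>= run w)
run-++ []      r q with run r q
... | just _  = refl
... | nothing = refl
run-++ (c ∷ w) r q rewrite run-++ w r q with run r q
... | just _  = refl
... | nothing = refl

run-nothing : ∀ (w : Stack) {r q} → run r q ≡ nothing → run (w ++ r) q ≡ nothing
run-nothing w {r} {q} dead rewrite run-++ w r q | dead = refl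

cell-cases : ∀ c → c ∈ allCells ⊎ (∀ r → entry c r ≡ nothing)
cell-cases (cell 0 false) = inj₁ (here refl)
cell-cases (cell 0 true)  = inj₁ (there (here refl))
cell-cases (cell 1 false) = inj₁ (there (there (here refl)))
cell-cases (cell 1 true)  = inj₁ (there (there (there (here refl))))
cell-cases (cell 2 false) = inj₁ (there (there (there (there (here refl)))))
cell-cases (cell 2 true)  = inj₁ (there (there (there (there (there (here refl))))))
cell-cases (cell 3 false) = inj₁ (there (there (there (there (there (there (here refl)))))))
cell-cases (cell 3 true)  = inj₁ (there (there (there (there (there (there (there (here refl))))))))
cell-cases (cell (suc (suc (suc (suc _)))) _) = inj₂ λ _ → refl

length-∷ʳ : ∀ (w : Stack) c → length (w ∷ʳ c) ≡ suc (length w)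
length-∷ʳ w c = trans (length-++ w) (+-comm (length w) 1)

windowsUpTo-sound : ∀ k {q₀ q} acc (p : Stack → Bool) → run acc q₀ ≡ just q → T (windowsUpTo k q acc p) →
                    ∀ w → length w ≤ k → run (w ++ acc) q₀ ≡ nothing ⊎ T (p (w ++ acc))
windowsUpTo-sound k acc p ran ok w len with initLast w
windowsUpTo-sound zero    acc p ran ok .[] _ | [] = inj₂ ok
windowsUpTo-sound (suc k) acc p ran ok .[] _ | [] = inj₂ (proj₁ (Equivalence.to (T-∧ {p acc}) ok))
windowsUpTo-sound zero    acc p ran ok .(w ∷ʳ c) len | w ∷ʳ′ c with () ← subst (_≤ 0) (length-∷ʳ w c) len
windowsUpTo-sound (suc k) {q₀} {q} acc p ran ok .(w ∷ʳ c) len | w ∷ʳ′ c rewrite ∷ʳ-++ w c acc =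
  extend (cell-cases c) (step q c) refl
  where
  next : State → Bool
  next q′ = windowsUpTo k q′ (c ∷ acc) p
  deeper : All (λ c → T (maybe (λ q′ → windowsUpTo k q′ (c ∷ acc) p) true (step q c))) allCells
  deeper = all⁺ _ allCells (proj₂ (Equivalence.to (T-∧ {p acc}) ok))
  ran′ : run (c ∷ acc) q₀ ≡ step q c
  ran′ = cong (_>>= λ q′ → step q′ c) ran
  extend : c ∈ allCells ⊎ (∀ r → entry c r ≡ nothing) → ∀ s → step q c ≡ s →
           run (w ++ c ∷ acc) q₀ ≡ nothing ⊎ T (p (w ++ c ∷ acc))
  extend (inj₂ dead) _ _               = inj₁ (run-nothing w (trans ran′ (dead (row q))))
  extend (inj₁ c∈)   nothing   stepped = inj₁ (run-nothing w (trans ran′ stepped))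
  extend (inj₁ c∈)   (just q′) stepped =
    windowsUpTo-sound k (c ∷ acc) p (trans ran′ stepped) (subst (T ∘ maybe next true) stepped (All.lookup deeper c∈)) w
                      (ℕ.≤-pred (subst (_≤ suc k) (length-∷ʳ w c) len))

at-++ : ∀ {j} (w r : Stack) → j < length w → at j (w ++ r) ≡ at j w
at-++ {zero}  (c ∷ w) r _         = refl
at-++ {suc j} (c ∷ w) r (s≤s j<w) = at-++ w r j<w

linkedAt-++ : ∀ {j} (w r : Stack) → j < length w → linkedAt j (w ++ r) ≡ linkedAt j w
linkedAt-++ w r j<w = cong (maybe linked false) (at-++ w r j<w)

closeAt-++ : ∀ {j} (w r : Stack) → j < length w → closeAt j (w ++ r) ≡ closeAt j w ++ r
closeAt-++ {zero}        (c ∷ w)     r _ = refl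
closeAt-++ {suc zero}    (c ∷ [])    r (s≤s ())
closeAt-++ {suc zero}    (c ∷ d ∷ w) r _ = refl
closeAt-++ {suc (suc j)} (c ∷ w)     r (s≤s j<w) = cong (bump c ∷_) (closeAt-++ w r j<w)

adjacentDepths-++ : ∀ {j} (w r : Stack) → j < length w → adjacentDepths j (w ++ r) ≡ adjacentDepths j w
adjacentDepths-++ {zero}        w       r j<w = cong (λ b → when b 0) (linkedAt-++ w r j<w)
adjacentDepths-++ {suc zero}    w       r j<w =
  cong₂ (λ b b′ → when b 0 ++ when b′ 1) (linkedAt-++ w r (ℕ.<-trans (ℕ.n<1+n 0) j<w)) (linkedAt-++ w r j<w)
adjacentDepths-++ {suc (suc j)} (_ ∷ w) r (s≤s j<w) = cong (map suc) (adjacentDepths-++ w r j<w)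

complete⇒bounded : ∀ j cs → T (complete j cs) → j < length cs × j < 4
complete⇒bounded j cs ok with at j cs in found
... | just c = in-range j cs found , s≤s (subst (j ≤_) (≡ᵇ⇒≡ _ 3 ok) (ℕ.m≤n+m j (closedNbrs c)))
  where
  in-range : ∀ j cs {c} → at j cs ≡ just c → j < length cs
  in-range zero    (_ ∷ _)  _ = s≤s z≤n
  in-range (suc j) (_ ∷ cs) e = s≤s (in-range j cs e)

closable-++ : ∀ {j l} (w r : Stack) → j < length w → T (closable j (w ++ r) l) → T (closable j w l)
closable-++ {j} {l} w r j<w ok = Equivalence.from T-∧ (complete-w , Equivalence.from T-∧ (not-forbidden , small-w))
  where
  parts = Equivalence.to (T-∧ {complete j (w ++ r)}) ok
  rest = Equivalence.to (T-∧ {not (forbidden j l)}) (proj₂ parts)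
  not-forbidden = proj₁ rest
  complete-w = subst T (cong (maybe (λ c → closedNbrs c + j ≡ᵇ 3) false) (at-++ w r j<w)) (proj₁ parts)
  small-w = all⁻ atMost3 (++⁻ˡ (closeAt j w)
              (all⁺ atMost3 _ (subst (T ∘ all atMost3) (closeAt-++ w r j<w) (proj₂ rest))))

⇒ᵇ-elim : ∀ {a b} → T (a ⇒ᵇ b) → T a → T b
⇒ᵇ-elim {true} b _ = b

accepts-++ : ∀ {r q} (v : Stack) l → run r s0 ≡ just q → accepts (v ++ r) l ≡ acceptsFrom q v l
accepts-++ {r} v l ran =
  cong (maybe (λ q′ → isYes (l ∈? acceptedAfter q′)) false) (trans (run-++ v r s0) (cong (_>>= run v) ran))

MovesAccepted : Stack → LastMove → Set
MovesAccepted cs l = T (accepts (newCell l ∷ cs) pushed) ×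
                  (∀ j → T (closable j cs l) → T (accepts (closeAt j cs) (closed (adjacentDepths j cs))))

small-depth : ∀ {j} → j < 4 → j ∈ 0 ∷ 1 ∷ 2 ∷ 3 ∷ []
small-depth {0} _ = here refl
small-depth {1} _ = there (here refl)
small-depth {2} _ = there (there (here refl))
small-depth {3} _ = there (there (there (here refl)))
small-depth {suc (suc (suc (suc _)))} (s≤s (s≤s (s≤s (s≤s ()))))

certified : ∀ {q l} w → length w ≤ 4 → T (acceptsFrom q w l) → T (successorsAccepted q w l)
certified {q} {l} w short acc with windowsUpTo-sound 4 [] (windowClosed q) refl (certificate q) w short
... | in-window rewrite ++-identityʳ w = from-window (run w q) in-window acc
  where
  from-window : ∀ s → s ≡ nothing ⊎ T (maybe (λ q′ → all (successorsAccepted q w) (acceptedAfter q′)) true s) →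
                T (maybe (λ q′ → isYes (l ∈? acceptedAfter q′)) false s) → T (successorsAccepted q w l)
  from-window (just q′) (inj₂ all-ok) l∈ = All.lookup (all⁺ (successorsAccepted q w) _ all-ok) (toWitness l∈)

window-successors : ∀ {q l} (w r : Stack) → run r s0 ≡ just q → length w ≤ 4 →
                    (∀ j → T (complete j (w ++ r)) → j < length w) →
                    T (accepts (w ++ r) l) → MovesAccepted (w ++ r) l
window-successors {q} {l} w r ran short local acc = pushes , closes
  where
  moves = certified w short (subst T (accepts-++ w l ran) acc)
  parts = Equivalence.to (T-∧ {acceptsFrom q (newCell l ∷ w) pushed}) moves
  pushes = subst T (sym (accepts-++ (newCell l ∷ w) pushed ran)) (proj₁ parts)
  closes : ∀ j → T (closable j (w ++ r) l) → T (accepts (closeAt j (w ++ r)) (closed (adjacentDepths j (w ++ r))))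
  closes j ok = closes′ (local j (proj₁ (Equivalence.to T-∧ ok)))
    where
    closes′ : j < length w → T (accepts (closeAt j (w ++ r)) (closed (adjacentDepths j (w ++ r))))
    closes′ j<w =
      subst T (sym moved) (⇒ᵇ-elim (All.lookup (all⁺ (closeAccepted q w l) _ (proj₂ parts)) j-small) closable-w)
      where
      closable-w = closable-++ {l = l} w r j<w ok
      j-small = small-depth (proj₂ (complete⇒bounded j w (proj₁ (Equivalence.to T-∧ closable-w))))
      moved : accepts (closeAt j (w ++ r)) (closed (adjacentDepths j (w ++ r))) ≡
              acceptsFrom q (closeAt j w) (closed (adjacentDepths j w))
      moved = trans (cong₂ accepts (closeAt-++ w r j<w) (cong closed (adjacentDepths-++ w r j<w)))
                    (accepts-++ (closeAt j w) _ ran)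

accepted-moves : ∀ cs {l} → T (accepts cs l) → MovesAccepted cs l
accepted-moves cs {l} acc = subst (λ v → MovesAccepted v l) (take++drop≡id 4 cs) (from-bottom (run r s0) refl)
  where
  w = take 4 cs
  r = drop 4 cs
  acc′ : T (accepts (w ++ r) l)
  acc′ = subst (λ v → T (accepts v l)) (sym (take++drop≡id 4 cs)) acc
  short : length w ≤ 4
  short = subst (_≤ 4) (sym (length-take 4 cs)) (ℕ.m⊓n≤m 4 (length cs))
  local : ∀ j → T (complete j (w ++ r)) → j < length w
  local j ok with complete⇒bounded j (w ++ r) ok
  ... | in-range , j<4 = subst (j <_) (sym (length-take 4 cs))
                           (ℕ.⊓-pres-m< j<4 (subst (j <_) (cong length (take++drop≡id 4 cs)) in-range))
  from-bottom : ∀ m → run r s0 ≡ m → MovesAccepted (w ++ r) l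
  from-bottom nothing  dead = ⊥-elim (subst (T ∘ maybe _ false) (run-nothing w dead) acc′)
  from-bottom (just q) ran  = window-successors w r ran short local acc′

reachable⇒accepted : ∀ {cs l} → Reachable cs l → T (accepts cs l)
reachable⇒accepted start           = tt
reachable⇒accepted (push {cs} r)   = proj₁ (accepted-moves cs (reachable⇒accepted r))
reachable⇒accepted (close {cs} j ok r) = proj₂ (accepted-moves cs (reachable⇒accepted r)) j ok

never-emptied : ∀ {ds} → ¬ Reachable [] (closed ds)
never-emptied {ds} r with toWitness {a? = closed ds ∈? acceptedAfter s0} (reachable⇒accepted r)
... | here ()

-- Scanning a cubic word

module _ {m : ℕ} where

  -- For a letter o occurring once in the prefix P: b is a neighbour of o that has
  -- already closed, respectively b lies above o on the stack.
  closedNbr : Word m → Fin m → Fin m → Bool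
  closedNbr P o b = (occ b (after o P) ≡ᵇ 1) ∧ (occ b P ≡ᵇ 2)

  openAbove : Word m → Fin m → Fin m → Bool
  openAbove P o b = (occ b (after o P) ≡ᵇ 1) ∧ (occ b P ≡ᵇ 1)

  record Counts (P : Word m) (depth : ℕ) (o : Fin m) (c : Cell) : Set where
    field
      once         : occ o P ≡ 1
      closed-count : closedNbrs c ≡ count (closedNbr P o)
      depth-count  : depth ≡ count (openAbove P o)
  open Counts

  closedNbr-snoc : ∀ (P : Word m) {o x b} → occ o P ≡ 1 → b ≢ x → closedNbr (P ∷ʳ x) o b ≡ closedNbr P o b
  closedNbr-snoc P o-once b≢x =
    cong₂ (λ i j → (i ≡ᵇ 1) ∧ (j ≡ᵇ 2)) (occ-after-snoc-other P o-once b≢x) (occ-snoc-other P b≢x)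

  openAbove-snoc : ∀ (P : Word m) {o x b} → occ o P ≡ 1 → b ≢ x → openAbove (P ∷ʳ x) o b ≡ openAbove P o b
  openAbove-snoc P o-once b≢x =
    cong₂ (λ i j → (i ≡ᵇ 1) ∧ (j ≡ᵇ 1)) (occ-after-snoc-other P o-once b≢x) (occ-snoc-other P b≢x)

  push-counts : ∀ {P x i o c} → occ x P ≡ 0 → Counts P i o c → Counts (P ∷ʳ x) (suc i) o c
  push-counts {P} {x} {i} {o} {c} x∉P t = record
    { once         = trans (occ-snoc-other P o≢x) (once t)
    ; closed-count = trans (closed-count t) (count-cong same-closed)
    ; depth-count  = trans (cong suc (depth-count t))
                           (sym (count-insert (openAbove P o) (openAbove (P ∷ʳ x) o) x
                                  (λ b b≢x → sym (openAbove-snoc P (once t) b≢x)) was-closed now-open))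
    }
    where
    o≢x : o ≢ x
    o≢x o≡x = occ-≢ P x∉P (once t) (sym o≡x)
    x-after : occ x (after o (P ∷ʳ x)) ≡ 1
    x-after = trans (occ-after-snoc-self P x (once t)) (cong suc (after-absent P x∉P))
    x-once : occ x (P ∷ʳ x) ≡ 1
    x-once = first-occurrence P x∉P
    was-closed : openAbove P o x ≡ false
    was-closed rewrite after-absent {o = o} P x∉P = refl
    now-open : openAbove (P ∷ʳ x) o x ≡ true
    now-open rewrite x-after | x-once = refl
    same-closed : ∀ b → closedNbr P o b ≡ closedNbr (P ∷ʳ x) o b
    same-closed b with b ≟ x
    ... | no  b≢x  = sym (closedNbr-snoc P (once t) b≢x)
    ... | yes refl rewrite x-once | x∉P = trans (∧-zeroʳ _) (sym (∧-zeroʳ _))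

  new-counts : ∀ {P x} b → occ x P ≡ 0 → Counts (P ∷ʳ x) 0 x (cell 0 b)
  new-counts {P} {x} b x∉P = record
    { once         = first-occurrence P x∉P
    ; closed-count = sym (count-false λ b → cong (λ w → (occ b w ≡ᵇ 1) ∧ (occ b (P ∷ʳ x) ≡ᵇ 2)) nothing-after)
    ; depth-count  = sym (count-false λ b → cong (λ w → (occ b w ≡ᵇ 1) ∧ (occ b (P ∷ʳ x) ≡ᵇ 1)) nothing-after)
    }
    where
    nothing-after : after x (P ∷ʳ x) ≡ []
    nothing-after = after-first x P [] x∉P

  above-counts : ∀ {P x i o c} → occ x P ≡ 1 → occ x (before o P) ≡ 1 → Counts P i o c → Counts (P ∷ʳ x) i o (bump c)
  above-counts {P} {x} {i} {o} {c} x-once x-before t = record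
    { once         = trans (occ-snoc-other P o≢x) (once t)
    ; closed-count = trans (cong suc (closed-count t))
                           (sym (count-insert (closedNbr P o) (closedNbr (P ∷ʳ x) o) x
                                  (λ b b≢x → sym (closedNbr-snoc P (once t) b≢x)) was-open now-closed))
    ; depth-count  = trans (depth-count t) (count-cong same-open)
    }
    where
    o≢x : o ≢ x
    o≢x = occ-≢ (before o P) (occ-before o P) x-before
    x-after : occ x (after o P) ≡ 0
    x-after = ℕ.+-cancelˡ-≡ 1 _ _ (trans (sym (cong (_+ occ x (after o P)) x-before))
                                          (trans (sym (occ-split P (o≢x ∘ sym) (positive (once t)))) x-once))
    x-after′ : occ x (after o (P ∷ʳ x)) ≡ 1
    x-after′ = trans (occ-after-snoc-self P x (once t)) (cong suc x-after)
    x-twice : occ x (P ∷ʳ x) ≡ 2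
    x-twice = second-occurrence P x-once
    was-open : closedNbr P o x ≡ false
    was-open rewrite x-after = refl
    now-closed : closedNbr (P ∷ʳ x) o x ≡ true
    now-closed rewrite x-after′ | x-twice = refl
    same-open : ∀ b → openAbove P o b ≡ openAbove (P ∷ʳ x) o b
    same-open b with b ≟ x
    ... | no  b≢x  = sym (openAbove-snoc P (once t) b≢x)
    ... | yes refl rewrite x-after | x-after′ | x-twice = refl

  below-counts : ∀ {P x i o c} → occ x P ≡ 1 → occ o (before x P) ≡ 1 → Counts P (suc i) o c → Counts (P ∷ʳ x) i o c
  below-counts {P} {x} {i} {o} {c} x-once o-before t = record
    { once         = trans (occ-snoc-other P (x≢o ∘ sym)) (once t)
    ; closed-count = trans (closed-count t) (count-cong same-closed)
    ; depth-count  = suc-injective (trans (depth-count t)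
                       (count-insert (openAbove (P ∷ʳ x) o) (openAbove P o) x
                          (λ b b≢x → openAbove-snoc P (once t) b≢x) now-closed was-open))
    }
    where
    x≢o : x ≢ o
    x≢o = occ-≢ (before x P) (occ-before x P) o-before
    x-before : occ x (before o P) ≡ 0
    x-before = ℕ.+-cancelʳ-≡ 1 _ 0
                 (trans (cong (occ x (before o P) +_) (sym o-before)) (before-antisym P x≢o x-once (once t)))
    x-after : occ x (after o P) ≡ 1
    x-after = trans (sym (cong (_+ occ x (after o P)) x-before))
                    (trans (sym (occ-split P x≢o (positive (once t)))) x-once)
    x-after′ : occ x (after o (P ∷ʳ x)) ≡ 2
    x-after′ = trans (occ-after-snoc-self P x (once t)) (cong suc x-after)
    x-twice : occ x (P ∷ʳ x) ≡ 2
    x-twice = second-occurrence P x-once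
    was-open : openAbove P o x ≡ true
    was-open rewrite x-after | x-once = refl
    now-closed : openAbove (P ∷ʳ x) o x ≡ false
    now-closed rewrite x-after′ = refl
    same-closed : ∀ b → closedNbr P o b ≡ closedNbr (P ∷ʳ x) o b
    same-closed b with b ≟ x
    ... | no  b≢x  = sym (closedNbr-snoc P (once t) b≢x)
    ... | yes refl rewrite x-after | x-after′ | x-once = refl

  Entry : Set
  Entry = Fin m × Cell

  cells : List Entry → Stack
  cells = map proj₂

  Linked : Word m → Fin m → Cell → List Entry → Set
  Linked P o c []             = ¬ T (linked c)
  Linked P o c ((o′ , _) ∷ _) = T (linked c) → Adjacent P o′ o

  record EntryOf (P : Word m) (depth : ℕ) (o : Fin m) (c : Cell) (below : List Entry) : Set where
    field
      counts  : Counts P depth o c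
      earlier : All (λ e → occ (proj₁ e) (before o P) ≡ 1) below
      link    : Linked P o c below
  open EntryOf

  data StackOf (P : Word m) : ℕ → List Entry → Set where
    []  : ∀ {i} → StackOf P i []
    _∷_ : ∀ {i o c below} → EntryOf P i o c below → StackOf P (suc i) below → StackOf P i ((o , c) ∷ below)

  Linked-++ : ∀ {P o c} Q below → Linked P o c below → Linked (P ++ Q) o c below
  Linked-++ Q []      l = l
  Linked-++ Q (_ ∷ _) l = Adjacent-++ Q ∘ l

  earlier-snoc : ∀ (P : Word m) {o} {below : List Entry} x → occ o P ≡ 1 →
                 All (λ e → occ (proj₁ e) (before o P) ≡ 1) below →
                 All (λ e → occ (proj₁ e) (before o (P ∷ʳ x)) ≡ 1) below
  earlier-snoc P x o-once = All.map (trans (cong (occ _) (before-snoc P x o-once)))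

  stack-push : ∀ {P x i st} → occ x P ≡ 0 → StackOf P i st → StackOf (P ∷ʳ x) (suc i) st
  stack-push x∉P []      = []
  stack-push {P} {x} x∉P (s ∷ ss) =
    record { counts  = push-counts x∉P (counts s)
           ; earlier = earlier-snoc P x (once (counts s)) (earlier s)
           ; link    = Linked-++ (x ∷ []) _ (link s) }
    ∷ stack-push x∉P ss

  stack-lower : ∀ {P x i} {st : List Entry} → occ x P ≡ 1 → All (λ e → occ (proj₁ e) (before x P) ≡ 1) st →
                  StackOf P (suc i) st → StackOf (P ∷ʳ x) i st
  stack-lower x-once []         []       = []
  stack-lower {P} {x} x-once (o-before ∷ bs) (s ∷ ss) =
    record { counts  = below-counts x-once o-before (counts s)
           ; earlier = earlier-snoc P x (once (counts s)) (earlier s)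
           ; link    = Linked-++ (x ∷ []) _ (link s) }
    ∷ stack-lower x-once bs ss

  closeEntries : List Entry → List Entry
  closeEntries []                  = []
  closeEntries ((o , c) ∷ [])      = (o , unlink (bump c)) ∷ []
  closeEntries ((o , c) ∷ e ∷ es)  = (o , bump c) ∷ closeEntries (e ∷ es)

  closeAt-entries : ∀ pre (e : Entry) post →
                    closeAt (length pre) (cells (pre ++ e ∷ post)) ≡ cells (closeEntries pre ++ post)
  closeAt-entries []                  e post = refl
  closeAt-entries ((o , c) ∷ [])      e post = refl
  closeAt-entries ((o , c) ∷ e′ ∷ es) e post = cong (bump c ∷_) (closeAt-entries (e′ ∷ es) e post)

  All-close : ∀ {Q : Fin m → Set} pre (e : Entry) post →
              All (Q ∘ proj₁) (pre ++ e ∷ post) → All (Q ∘ proj₁) (closeEntries pre ++ post)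
  All-close []                  e post (_ ∷ qs)  = qs
  All-close ((o , c) ∷ [])      e post (q ∷ _ ∷ qs) = q ∷ qs
  All-close ((o , c) ∷ e′ ∷ es) e post (q ∷ qs)  = q ∷ All-close (e′ ∷ es) e post qs

  All-at : ∀ {Q : Entry → Set} pre (e : Entry) post → All Q (pre ++ e ∷ post) → Q e
  All-at []        e post (q ∷ _)  = q
  All-at (_ ∷ pre) e post (_ ∷ qs) = All-at pre e post qs

  Linked-close : ∀ {P o c} o₂ c₂ es e post → Linked P o c ((o₂ , c₂) ∷ es ++ e ∷ post) →
                 Linked P o c (closeEntries ((o₂ , c₂) ∷ es) ++ post)
  Linked-close o₂ c₂ []       e post l = l
  Linked-close o₂ c₂ (_ ∷ _)  e post l = l

  stack-close : ∀ {P x i} pre c post → occ x P ≡ 1 → StackOf P i (pre ++ (x , c) ∷ post) →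
                StackOf (P ∷ʳ x) i (closeEntries pre ++ post)
  stack-close [] c post x-once (s ∷ ss) = stack-lower x-once (earlier s) ss
  stack-close {P} {x} ((o , c₁) ∷ []) c post x-once (s ∷ sx ∷ ss) =
    record { counts  = unlinked (above-counts x-once (All.head (earlier s)) (counts s))
           ; earlier = earlier-snoc P x (once (counts s)) (All.tail (earlier s))
           ; link    = unlinked-link {bump c₁} post }
    ∷ stack-lower x-once (earlier sx) ss
    where
    unlinked : ∀ {i o c} → Counts (P ∷ʳ x) i o c → Counts (P ∷ʳ x) i o (unlink c)
    unlinked t = record { once = once t ; closed-count = closed-count t ; depth-count = depth-count t }
    unlinked-link : ∀ {c} below → Linked (P ∷ʳ x) o (unlink c) below
    unlinked-link []      ()
    unlinked-link (_ ∷ _) ()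
  stack-close {P} {x} ((o , c₁) ∷ (o₂ , c₂) ∷ es) c post x-once (s ∷ ss) =
    record { counts  = above-counts x-once (All-at ((o₂ , c₂) ∷ es) (x , c) post (earlier s)) (counts s)
           ; earlier = earlier-snoc P x (once (counts s)) (All-close ((o₂ , c₂) ∷ es) (x , c) post (earlier s))
           ; link    = Linked-++ (x ∷ []) _ (Linked-close o₂ c₂ es (x , c) post (link s)) }
    ∷ stack-close ((o₂ , c₂) ∷ es) c post x-once ss

  letters : List Entry → Word m
  letters = map proj₁

  letterAt : ℕ → List Entry → Maybe (Fin m)
  letterAt j st = at j (letters st)

  EndsWithTop : Word m → List Entry → Set
  EndsWithTop P []            = ⊥
  EndsWithTop P ((o , _) ∷ _) = Σ (Word m) λ P₀ → P ≡ P₀ ∷ʳ o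

  record JustClosed (P : Word m) (st : List Entry) (ds : List ℕ) : Set where
    field
      last   : Fin m
      prefix : Word m
      ends   : P ≡ prefix ∷ʳ last
      twice  : occ last P ≡ 2
      nbrs   : ∀ j → T (forbidden j (closed ds)) →
               Σ (Fin m) λ o → letterAt j st ≡ just o × AdjacentEither prefix last o

  Recent : Word m → List Entry → LastMove → Set
  Recent P st start       = P ≡ []
  Recent P st pushed      = EndsWithTop P st
  Recent P st (closed ds) = JustClosed P st ds

  entry-at : ∀ {P i} pre o c post → StackOf P i (pre ++ (o , c) ∷ post) → EntryOf P (length pre + i) o c post
  entry-at []        o c post (s ∷ _)  = s
  entry-at {P} {i} (_ ∷ pre) o c post (_ ∷ ss) =
    subst (λ k → EntryOf P k o c post) (ℕ.+-suc (length pre) i) (entry-at pre o c post ss)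

  forbidden-when : ∀ j b k → T (any (j ≡ᵇ_) (when b k)) → T b × j ≡ k
  forbidden-when j true k ok with any⁻ (j ≡ᵇ_) (k ∷ []) ok
  ... | here j≡k = _ , ≡ᵇ⇒≡ j k j≡k

  forbidden-++ : ∀ {j} ds es → T (any (j ≡ᵇ_) (ds ++ es)) → T (any (j ≡ᵇ_) ds) ⊎ T (any (j ≡ᵇ_) es)
  forbidden-++ {j} ds es ok with Any.++⁻ ds (any⁻ (j ≡ᵇ_) (ds ++ es) ok)
  ... | inj₁ in-ds = inj₁ (any⁺ (j ≡ᵇ_) in-ds)
  ... | inj₂ in-es = inj₂ (any⁺ (j ≡ᵇ_) in-es)

  forbidden-suc : ∀ j ds → T (any (j ≡ᵇ_) (map suc ds)) → Σ ℕ λ j′ → j ≡ suc j′ × T (any (j′ ≡ᵇ_) ds)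
  forbidden-suc zero    (d ∷ ds) ok with () ← proj₁ (proj₂ (forbidden-suc zero ds ok))
  forbidden-suc (suc j) ds       ok = j , refl , subst T (shift ds) ok
    where
    shift : ∀ ds → any (suc j ≡ᵇ_) (map suc ds) ≡ any (j ≡ᵇ_) ds
    shift []       = refl
    shift (d ∷ ds) = cong ((j ≡ᵇ d) ∨_) (shift ds)

  nbr-below : ∀ {P x c} post → Linked P x c post → T (linked c) →
              Σ (Fin m) λ o → letterAt 0 post ≡ just o × AdjacentEither P x o
  nbr-below []              l t = ⊥-elim (l t)
  nbr-below ((o , _) ∷ _)   l t = o , refl , inj₂ (l t)

  closed-nbrs : ∀ {P i x c} pre post → StackOf P i (pre ++ (x , c) ∷ post) →
                ∀ j → T (forbidden j (closed (adjacentDepths (length pre) (cells (pre ++ (x , c) ∷ post))))) →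
                Σ (Fin m) λ o → letterAt j (closeEntries pre ++ post) ≡ just o × AdjacentEither P x o
  closed-nbrs {c = c} [] post (s ∷ _) j ok with forbidden-when j (linked c) 0 ok
  ... | t , refl = nbr-below post (link s) t
  closed-nbrs {c = c} ((o₁ , c₁) ∷ []) post (s₁ ∷ s ∷ _) j ok
    with forbidden-++ {j} (when (linked c₁) 0) (when (linked c) 1) ok
  ... | inj₁ above with forbidden-when j (linked c₁) 0 above
  ...   | t , refl = o₁ , refl , inj₁ (link s₁ t)
  closed-nbrs {c = c} ((o₁ , c₁) ∷ []) post (s₁ ∷ s ∷ _) j ok | inj₂ below
    with forbidden-when j (linked c) 1 below
  ...   | t , refl with nbr-below post (link s) t
  ...     | o , found , adj = o , found , adj
  closed-nbrs {x = x} {c} (e₀ ∷ e₁ ∷ es) post (_ ∷ ss) j ok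
    with forbidden-suc j (adjacentDepths (suc (length es)) (cells ((e₁ ∷ es) ++ (x , c) ∷ post))) ok
  ... | j′ , refl , ok′ = closed-nbrs (e₁ ∷ es) post ss j′ ok′

  CoversOpen : Word m → List Entry → Set
  CoversOpen P st = ∀ b → occ b P ≡ 1 → Any (λ e → proj₁ e ≡ b) st

  find : ∀ x (st : List Entry) →
         (Σ (List Entry) λ pre → Σ Cell λ c → Σ (List Entry) λ post → st ≡ pre ++ (x , c) ∷ post) ⊎
         ¬ Any (λ e → proj₁ e ≡ x) st
  find x []             = inj₂ λ ()
  find x ((o , c) ∷ st) with o ≟ x | find x st
  ... | yes refl | _                             = inj₁ ([] , c , st , refl)
  ... | no  _    | inj₁ (pre , c′ , post , refl) = inj₁ ((o , c) ∷ pre , c′ , post , refl)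
  ... | no  o≢x  | inj₂ x∉st                     = inj₂ λ { (here o≡x) → o≢x o≡x ; (there x∈st) → x∉st x∈st }

  Any-close : ∀ {b} pre (e : Entry) post → Any (λ e → proj₁ e ≡ b) (pre ++ e ∷ post) → b ≢ proj₁ e →
              Any (λ e → proj₁ e ≡ b) (closeEntries pre ++ post)
  Any-close []                  e post (here e≡b)          b≢e = ⊥-elim (b≢e (sym e≡b))
  Any-close []                  e post (there b∈)          _   = b∈
  Any-close ((o , c) ∷ [])      e post (here o≡b)          _   = here o≡b
  Any-close ((o , c) ∷ [])      e post (there (here e≡b))  b≢e = ⊥-elim (b≢e (sym e≡b))
  Any-close ((o , c) ∷ [])      e post (there (there b∈))  _   = there b∈
  Any-close ((o , c) ∷ e′ ∷ es) e post (here o≡b)          _   = here o≡b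
  Any-close ((o , c) ∷ e′ ∷ es) e post (there b∈)          b≢e = there (Any-close (e′ ∷ es) e post b∈ b≢e)

  stack-once : ∀ {P i st} → StackOf P i st → All (λ e → occ (proj₁ e) P ≡ 1) st
  stack-once []       = []
  stack-once (s ∷ ss) = once (counts s) ∷ stack-once ss

  top-entry : ∀ {P x l st} → occ x P ≡ 0 → StackOf P 0 st → Recent P st l → EntryOf (P ∷ʳ x) 0 x (newCell l) st
  top-entry {P} {x} {l} {st} x∉P ss recent = record
    { counts  = new-counts (isPushed l) x∉P
    ; earlier = All.map (trans (cong (occ _) (before-first x P [] x∉P))) (stack-once ss)
    ; link    = pushed-link l st recent }
    where
    pushed-link : ∀ l st → Recent P st l → Linked (P ∷ʳ x) x (newCell l) st
    pushed-link start       []            _ ()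
    pushed-link (closed _)  []            _ ()
    pushed-link pushed      []            ()
    pushed-link pushed      ((o , _) ∷ _) (P₀ , refl) _ = P₀ , [] , ++-assoc P₀ (o ∷ []) (x ∷ [])

  letterAt-middle : ∀ pre (o : Fin m) c post → letterAt (length pre) (pre ++ (o , c) ∷ post) ≡ just o
  letterAt-middle []        o c post = refl
  letterAt-middle (_ ∷ pre) o c post = letterAt-middle pre o c post

  cellAt-middle : ∀ pre (o : Fin m) c post → at (length pre) (cells (pre ++ (o , c) ∷ post)) ≡ just c
  cellAt-middle []        o c post = refl
  cellAt-middle (_ ∷ pre) o c post = cellAt-middle pre o c post

module Scan {m : ℕ} (a₀ : Fin m) (W : Word m) (dow : DoubleOccurrence W)
            (cubic : ∀ a → count (interlacedᵇ W a) ≡ 3) where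

  open Counts
  open EntryOf

  occ-≤-2 : ∀ P S b → W ≡ P ++ S → occ b P ≤ 2
  occ-≤-2 P S b W≡ = ℕ.≤-trans (ℕ.m≤m+n (occ b P) (occ b S))
                               (ℕ.≤-reflexive (trans (sym (occ-++ b P S)) (trans (cong (occ b) (sym W≡)) (dow b))))

  closing-degree : ∀ P x S → W ≡ P ++ x ∷ S → occ x P ≡ 1 → count (closedNbr P x) + count (openAbove P x) ≡ 3
  closing-degree P x S W≡ x-once = trans (sym (count-split _ _ _ split)) (trans (count-cong between-after) (cubic x))
    where
    W≡′ : W ≡ before x P ++ x ∷ after x P ++ x ∷ S
    W≡′ = trans W≡ (trans (cong (_++ x ∷ S) (split-first x P (positive x-once))) (++-assoc (before x P) _ _))
    between-after : ∀ b → (occ b (after x P) ≡ᵇ 1) ≡ interlacedᵇ W x b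
    between-after b = cong (λ w → occ b w ≡ᵇ 1) (sym (between-first (before x P) (after x P) S (dow x) W≡′))
    split : ∀ b → indicator (occ b (after x P) ≡ᵇ 1) ≡ indicator (closedNbr P x b) + indicator (openAbove P x b)
    split b = split-by-total _ _ (occ-after-≤ x b P) (occ-≤-2 P (x ∷ S) b W≡)

  closed-interlaced : ∀ P S {o} → W ≡ P ++ S → occ o P ≡ 1 → ∀ b → closedNbr P o b ≡ true → interlacedᵇ W o b ≡ true
  closed-interlaced P S {o} W≡ o-once b closed-b = cong (_≡ᵇ 1) (begin
    occ b (between o W)                          ≡⟨ cong (λ w → occ b (between o w)) W≡ ⟩
    occ b (before o (after o (P ++ S)))          ≡⟨ cong (occ b ∘ before o) (after-++ o P S (positive o-once)) ⟩
    occ b (before o (after o P ++ S))            ≡⟨ cong (occ b) (before-++-absent o (after o P) S o∉after) ⟩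
    occ b (after o P ++ before o S)              ≡⟨ occ-++ b (after o P) (before o S) ⟩
    occ b (after o P) + occ b (before o S)       ≡⟨ cong₂ _+_ once-after none-before ⟩
    1                                            ∎)
    where
    open ≡-Reasoning
    o∉after = after-self-absent P o-once
    parts = ∧-true {occ b (after o P) ≡ᵇ 1} closed-b
    once-after = ≡ᵇ⇒≡ _ 1 (subst T (sym (proj₁ parts)) tt)
    twice-in-P = ≡ᵇ⇒≡ _ 2 (subst T (sym (proj₂ parts)) tt)
    none-in-S : occ b S ≡ 0
    none-in-S = ℕ.+-cancelˡ-≡ 2 _ 0 (trans (cong (_+ occ b S) (sym twice-in-P))
                                       (trans (sym (occ-++ b P S)) (trans (cong (occ b) (sym W≡)) (dow b))))
    none-before = ℕ.n≤0⇒n≡0 (ℕ.≤-trans (occ-before-≤ o b S) (ℕ.≤-reflexive none-in-S))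

  closed-bounded : ∀ P S {o} → W ≡ P ++ S → occ o P ≡ 1 → count (closedNbr P o) ≤ 3
  closed-bounded P S {o} W≡ o-once =
    ℕ.≤-trans (count-mono _ _ (closed-interlaced P S W≡ o-once)) (ℕ.≤-reflexive (cubic o))

  stack-small : ∀ P S {i st} → W ≡ P ++ S → StackOf P i st → T (all atMost3 (cells st))
  stack-small P S W≡ []       = tt
  stack-small P S W≡ (s ∷ ss) =
    Equivalence.from T-∧ (ℕ.≤⇒≤ᵇ small , stack-small P S W≡ ss)
    where small = subst (_≤ 3) (sym (closed-count (counts s))) (closed-bounded P S W≡ (once (counts s)))

  twins-after-close : ∀ {P S st ds j x} → W ≡ P ++ x ∷ S → occ x P ≡ 1 → JustClosed P st ds →
                      letterAt j st ≡ just x → T (forbidden j (closed ds)) → Twins W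
  twins-after-close {P} {S} {j = j} {x} W≡ x-once jc x-at forbidden-j with JustClosed.nbrs jc j forbidden-j
  ... | o , o-at , adj with trans (sym o-at) x-at
  ... | refl = twins adj
    where
    open JustClosed jc
    last≢x : last ≢ x
    last≢x refl with () ← trans (sym twice) x-once
    W≡′ : W ≡ prefix ++ last ∷ x ∷ S
    W≡′ = trans W≡ (trans (cong (_++ x ∷ S) ends) (++-assoc prefix (last ∷ []) (x ∷ S)))
    regroup′ : ∀ A a b B → (A ++ a ∷ b ∷ B) ++ last ∷ x ∷ S ≡ A ++ a ∷ b ∷ B ++ last ∷ x ∷ S
    regroup′ A a b B = ++-assoc A (a ∷ b ∷ B) (last ∷ x ∷ S)
    twins : AdjacentEither prefix last x → Twins W
    twins (inj₁ (A , B , refl)) = record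
      { u = last ; v = x ; distinct = last≢x ; p = A ; q = B ; r = S ; shape = inj₁ (trans W≡′ (regroup′ A last x B)) }
    twins (inj₂ (A , B , refl)) = record
      { u = x ; v = last ; distinct = last≢x ∘ sym ; p = A ; q = B ; r = S ; shape = inj₂ (trans W≡′ (regroup′ A x last B)) }

  record Scanned (P : Word m) : Set where
    field
      stack     : List Entry
      lastMove  : LastMove
      stacked   : StackOf P 0 stack
      opened    : CoversOpen P stack
      recent    : Recent P stack lastMove
      reachable : Reachable (cells stack) lastMove
  open Scanned

  scanned-[] : Scanned []
  scanned-[] = record
    { stack = [] ; lastMove = start ; stacked = [] ; opened = λ _ () ; recent = refl ; reachable = start }

  push-step : ∀ {P x} → occ x P ≡ 0 → Scanned P → Scanned (P ∷ʳ x)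
  push-step {P} {x} x∉P sc = record
    { stack     = (x , newCell (lastMove sc)) ∷ stack sc
    ; lastMove  = pushed
    ; stacked   = top-entry x∉P (stacked sc) (recent sc) ∷ stack-push x∉P (stacked sc)
    ; opened    = opened′
    ; recent    = P , refl
    ; reachable = push (reachable sc) }
    where
    opened′ : CoversOpen (P ∷ʳ x) ((x , newCell (lastMove sc)) ∷ stack sc)
    opened′ b b-once with b ≟ x
    ... | yes refl = here refl
    ... | no  b≢x  = there (opened sc b (trans (sym (occ-snoc-other P b≢x)) b-once))

  close-step : ∀ {P S x l} pre c post → W ≡ P ++ x ∷ S → StackOf P 0 (pre ++ (x , c) ∷ post) →
               CoversOpen P (pre ++ (x , c) ∷ post) → Reachable (cells (pre ++ (x , c) ∷ post)) l →
               forbidden (length pre) l ≡ false → Scanned (P ∷ʳ x)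
  close-step {P} {S} {x} {l} pre c post W≡ ss opened-P reached forb = record
    { stack     = closeEntries pre ++ post
    ; lastMove  = closed ds
    ; stacked   = stacked′
    ; opened    = opened′
    ; recent    = record { last = x ; prefix = P ; ends = refl ; twice = x-twice ; nbrs = closed-nbrs pre post ss }
    ; reachable = subst (λ cs → Reachable cs (closed ds)) (closeAt-entries pre (x , c) post)
                        (close (length pre) closable-x reached) }
    where
    ds = adjacentDepths (length pre) (cells (pre ++ (x , c) ∷ post))
    t = counts (entry-at pre x c post ss)
    x-twice : occ x (P ∷ʳ x) ≡ 2
    x-twice = second-occurrence P (once t)
    stacked′ : StackOf (P ∷ʳ x) 0 (closeEntries pre ++ post)
    stacked′ = stack-close pre c post (once t) ss
    complete-degree : closedNbrs c + length pre ≡ 3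
    complete-degree = trans (cong₂ _+_ (closed-count t) (trans (sym (+-identityʳ (length pre))) (depth-count t)))
                            (closing-degree P x S W≡ (once t))
    closable-x : T (closable (length pre) (cells (pre ++ (x , c) ∷ post)) l)
    closable-x rewrite cellAt-middle pre x c post | complete-degree | forb | closeAt-entries pre (x , c) post =
      stack-small (P ∷ʳ x) S (trans W≡ (sym (++-assoc P (x ∷ []) S))) stacked′
    opened′ : CoversOpen (P ∷ʳ x) (closeEntries pre ++ post)
    opened′ b b-once = Any-close pre (x , c) post (opened-P b (trans (sym (occ-snoc-other P b≢x)) b-once)) b≢x
      where
      b≢x : b ≢ x
      b≢x refl with () ← trans (sym b-once) x-twice

  scan-letter : ∀ {P x S} → W ≡ P ++ x ∷ S → Scanned P → Twins W ⊎ Scanned (P ∷ʳ x)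
  scan-letter {P} {x} {S} W≡ sc with find x (stack sc)
  ... | inj₂ x∉st = inj₂ (push-step x∉P sc)
    where
    x∉P : occ x P ≡ 0
    x∉P with occ x P in x-in-P | occ-mid x P S
    ... | 0           | _     = refl
    ... | 1           | _     = ⊥-elim (x∉st (opened sc x x-in-P))
    ... | suc (suc _) | total with () ← trans (sym total) (trans (cong (occ x) (sym W≡)) (dow x))
  ... | inj₁ (pre , c , post , on-stack) =
    decide (lastMove sc) on-stack (stacked sc) (opened sc) (recent sc) (reachable sc)
    where
    decide : ∀ l {st} → st ≡ pre ++ (x , c) ∷ post → StackOf P 0 st → CoversOpen P st → Recent P st l →
             Reachable (cells st) l → Twins W ⊎ Scanned (P ∷ʳ x)
    decide l refl ss opened-P recent-P reached with forbidden (length pre) l in forb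
    decide (closed ds) refl ss _ jc _ | true =
      inj₁ (twins-after-close W≡ (once (counts (entry-at pre x c post ss))) jc
                              (letterAt-middle pre x c post) (subst T (sym forb) tt))
    ... | false = inj₂ (close-step pre c post W≡ ss opened-P reached forb)

  ended : ∀ {P} → W ≡ P → Scanned P → ⊥
  ended {P} W≡ sc with stack sc | lastMove sc | stacked sc | recent sc | reachable sc
  ... | [] | start     | _ | P≡[] | _ with () ← trans (sym (dow a₀)) (cong (occ a₀) (trans W≡ P≡[]))
  ... | [] | closed _  | _ | _    | r = never-emptied r
  ... | (o , _) ∷ _ | _ | s ∷ _ | _ | _ with () ← trans (sym (once (counts s))) (trans (cong (occ o) (sym W≡)) (dow o))

  scan : ∀ P S → W ≡ P ++ S → Scanned P → Twins W
  scan P []      W≡ sc = ⊥-elim (ended (trans W≡ (++-identityʳ P)) sc)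
  scan P (x ∷ S) W≡ sc with scan-letter W≡ sc
  ... | inj₁ twins = twins
  ... | inj₂ sc′   = scan (P ∷ʳ x) S (trans W≡ (sym (++-assoc P (x ∷ []) S))) sc′

  twins-exist : Twins W
  twins-exist = scan [] W refl scanned-[]

-- Splits of cubic circle graphs

twins⇒split : (G : Graph) → 4 ≤ n G → (p q : Fin (n G)) → p ≢ q →
              (∀ w → w ≢ p → w ≢ q → Adj G p w ≡ Adj G q w) → HasSplit G
twins⇒split G four p q p≢q same = side , side , X₂ , two-inside , two-outside , (λ _ h → h) , X₂-outside , edges
  where
  side : Fin (n G) → Bool
  side w = singleton p w ∨ singleton q w
  X₂ : Fin (n G) → Bool
  X₂ w = not (side w) ∧ Adj G p w
  two-inside : 2 ≤ countB side
  two-inside = subst (2 ≤_) (sym (trans (countB≡count side) (count-pair p≢q))) ℕ.≤-refl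
  two-outside : 2 ≤ countB (not ∘ side)
  two-outside = subst (2 ≤_) (sym (countB≡count (not ∘ side))) (ℕ.+-cancelˡ-≤ 2 2 _ (subst (4 ≤_) (sym sizes) four))
    where
    sizes : 2 + count (not ∘ side) ≡ n G
    sizes = trans (cong (_+ count (not ∘ side)) (sym (count-pair p≢q))) (count-complement side)
  X₂-outside : ∀ v → X₂ v ≡ true → side v ≡ false
  X₂-outside v h with side v
  ... | false = refl
  outside-distinct : ∀ {v} → side v ≡ false → v ≢ p × v ≢ q
  outside-distinct {v} h with v ≟ p | v ≟ q
  ... | no v≢p | no v≢q = v≢p , v≢q
  like-p : ∀ u v → side u ≡ true → side v ≡ false → Adj G u v ≡ Adj G p v
  like-p u v hu hv with u ≟ p | u ≟ q
  ... | yes refl | _     = refl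
  ... | no _     | yes refl = sym (same v (proj₁ (outside-distinct hv)) (proj₂ (outside-distinct hv)))
  edges : ∀ u v → side u ≡ true → side v ≡ false → (Adj G u v ≡ true ⇔ (side u ≡ true × X₂ v ≡ true))
  edges u v hu hv rewrite like-p u v hu hv = mk⇔ (λ a → hu , X₂-from a) (λ (_ , x₂) → Adj-from x₂)
    where
    X₂-from : Adj G p v ≡ true → X₂ v ≡ true
    X₂-from a rewrite hv | a = refl
    Adj-from : X₂ v ≡ true → Adj G p v ≡ true
    Adj-from x₂ rewrite hv = x₂

T⇔-≡ : ∀ {b c : Bool} → (T b ⇔ c ≡ true) → b ≡ c
T⇔-≡ {true}  {true}  _ = refl
T⇔-≡ {false} {false} _ = refl
T⇔-≡ {true}  {false} e with () ← Equivalence.to e tt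
T⇔-≡ {false} {true}  e with () ← Equivalence.from e refl

module Presentation (G : Graph) {m} {W : Word m} (dow : DoubleOccurrence W) (σ : Fin (n G) ⤖ Fin m)
                    (adj⇔ : ∀ u v → T (Adj G u v) ⇔ Interlaced W (Bijection.to σ u) (Bijection.to σ v)) where

  open Bijection σ using (injective; surjective) renaming (to to τ)

  vertex : Fin m → Fin (n G)
  vertex a = proj₁ (surjective a)

  τ-vertex : ∀ a → τ (vertex a) ≡ a
  τ-vertex a = proj₂ (surjective a) refl

  adj-vertex : ∀ a u → Adj G (vertex a) u ≡ interlacedᵇ W a (τ u)
  adj-vertex a u = trans (T⇔-≡ (mk⇔ (interlaced⇒ dow ∘ Equivalence.to (adj⇔ (vertex a) u))
                                     (Equivalence.from (adj⇔ (vertex a) u) ∘ interlaced⇐ dow)))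
                         (cong (λ b → interlacedᵇ W b (τ u)) (τ-vertex a))

  letter-degree : ∀ {k} → Regular k G → ∀ a → count (interlacedᵇ W a) ≡ k
  letter-degree regular a = begin
    count (interlacedᵇ W a)               ≡⟨ count-permute (⤖⇒↔ σ) (interlacedᵇ W a) ⟨
    count (λ u → interlacedᵇ W a (τ u))   ≡⟨ count-cong (λ u → sym (adj-vertex a u)) ⟩
    count (Adj G (vertex a))              ≡⟨ countB≡count (Adj G (vertex a)) ⟨
    countB (Adj G (vertex a))             ≡⟨ regular (vertex a) ⟩
    _                                     ∎
    where open ≡-Reasoning

  vertex-twins : (tw : Twins W) → let open Twins tw in
                 vertex u ≢ vertex v × (∀ w → w ≢ vertex u → w ≢ vertex v → Adj G (vertex u) w ≡ Adj G (vertex v) w)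
  vertex-twins tw = distinct-vertices , same-nbrs
    where
    open Twins tw using (u; v; distinct)
    distinct-vertices : vertex u ≢ vertex v
    distinct-vertices same = distinct (trans (sym (τ-vertex u)) (trans (cong τ same) (τ-vertex v)))
    off : ∀ {w} a → w ≢ vertex a → τ w ≢ a
    off a w≢ τw≡a = w≢ (injective (trans τw≡a (sym (τ-vertex a))))
    same-nbrs : ∀ w → w ≢ vertex u → w ≢ vertex v → Adj G (vertex u) w ≡ Adj G (vertex v) w
    same-nbrs w w≢u w≢v =
      trans (adj-vertex u w) (trans (twins-alike dow tw (off u w≢u) (off v w≢v)) (sym (adj-vertex v w)))

corollary6 : (G : Graph) → Regular 3 G → CircleGraph G → ¬ Prime G
corollary6 G cubic (m , W , dow , σ , adj⇔) (five , no-split) =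
  no-split (uncurry (twins⇒split G (ℕ.≤-trans (ℕ.n≤1+n 4) five) (vertex u) (vertex v)) (vertex-twins twins))
  where
  open Presentation G dow σ adj⇔
  some-letter : Fin m
  some-letter = Bijection.to σ (fromℕ< (ℕ.≤-trans (s≤s z≤n) five))
  twins : Twins W
  twins = Scan.twins-exist some-letter W dow (letter-degree cubic)
  open Twins twins using (u; v)
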